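{- Let $\frac12\le p\le 1$. For the online problem Edge-2-Coloring(Path), the randomized algorithm $\mathrm{RP}_p$ has competitive ratio $$C_{\mathrm{RP}_p}^{\text{Path}}(2)=\min\left\{p^2-p+1,\ \tfrac23(-p^2+p+1)\right\}.$$
   Context: Online dual edge coloring, Edge-$k$-Coloring: a number $k$ of colors $1,\dots,k$ is given. The edges of a simple graph arrive one by one, each specified by its two endpoints. Upon arrival, an edge must irrevocably either be colored with one of the $k$ colors, such that no two adjacent (sharing an endpoint) colored edges receive the same color, or be rejected. The goal is to color as many edges as possible. Edge-2-Coloring(Path) is the case $k=2$ with the input graph being a path. Competitive ratio of a randomized algorithm: for an input sequence $\sigma$, let $E[\mathrm{ALG}(\sigma)]$ be the expected number of edges colored and $\mathrm{OPT}(\sigma)$ the maximum number of edges of the input graph that can be properly colored with $k$ colors. ALG is $C$-competitive if there is a constant $b$ with $E[\mathrm{ALG}(\sigma)]\ge C\cdot\mathrm{OPT}(\sigma)-b$ for all inputs $\sigma$; the competitive ratio is the supremum of all such $C$. An isolated edge is an edge $(u,v)$ such that, at the time it is revealed, no previously revealed edge is incident to $u$ or $v$. The algorithm $\mathrm{RP}_p$ (for $\frac12\le p\le1$): whenever an isolated edge is revealed, it colors it with color 1 with probability $p$ and with color 2 with probability $1-p$; every non-isolated edge is colored with the remaining available color if possible, and rejected otherwise.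
   Formalization: The parameter p ranges over the rationals with $\frac12\le p\le 1$. -}

module Defs where

open import Data.Bool using (Bool; true; false; not; _∧_; _∨_; if_then_else_)
open import Data.Nat as ℕ using (ℕ; zero; suc; _≡ᵇ_)
open import Data.Integer using (+_)
open import Data.Rational using (ℚ; _+_; _*_; _-_; _≤_; _<_; _⊓_; 0ℚ; 1ℚ; _/_)
open import Data.Maybe using (Maybe; just; nothing)
open import Data.List using (List; []; _∷_; length)
open import Data.Bool.ListAction using (any)
open import Data.List.Relation.Unary.All using (All)
open import Data.List.Relation.Unary.AllPairs using (AllPairs)
open import Data.List.Relation.Unary.Unique.Propositional using (Unique)
open import Data.List.Relation.Binary.Permutation.Propositional using (_↭_)
open import Data.List.Relation.Binary.Pointwise using (Pointwise)
open import Data.Product using (_×_; _,_; Σ; ∃; ∃-syntax; proj₁; proj₂)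
open import Data.Sum using (_⊎_)
open import Relation.Binary.PropositionalEquality using (_≡_)
open import Relation.Nullary using (¬_)

Edge : Set
Edge = ℕ × ℕ

Input : Set
Input = List Edge

SameEdge : Edge → Edge → Set
SameEdge (a , b) (c , d) = (a ≡ c × b ≡ d) ⊎ (a ≡ d × b ≡ c)

pathEdges : List ℕ → List Edge
pathEdges []             = []
pathEdges (v ∷ [])       = []
pathEdges (v ∷ w ∷ vs)   = (v , w) ∷ pathEdges (w ∷ vs)

-- The input graph (the set of revealed edges) is a path: there is a list of
-- pairwise distinct vertices such that the revealed edges are exactly the
-- edges of the path through them, each revealed exactly once (in any order,
-- with any orientation).
IsPathInput : Input → Set
IsPathInput σ =
  ∃[ vs ] ∃[ τ ] (Unique vs × (σ ↭ τ) × Pointwise SameEdge τ (pathEdges vs))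

Adjacent : Edge → Edge → Set
Adjacent (a , b) (c , d) = a ≡ c ⊎ a ≡ d ⊎ b ≡ c ⊎ b ≡ d

Clash : Maybe ℕ → Maybe ℕ → Set
Clash m m' = ∃[ c ] (m ≡ just c × m' ≡ just c)

-- a partial coloring: for each edge of σ (in order) either nothing (not
-- colored) or a color; colors must lie in {1,…,k}
ValidColors : ℕ → List (Maybe ℕ) → Set
ValidColors k cs = All (λ m → ∀ c → m ≡ just c → (1 ℕ.≤ c × c ℕ.≤ k)) cs

zipE : Input → List (Maybe ℕ) → List (Edge × Maybe ℕ)
zipE []       _        = []
zipE _        []       = []
zipE (e ∷ σ)  (m ∷ cs) = (e , m) ∷ zipE σ cs

Proper : Input → List (Maybe ℕ) → Set
Proper σ cs =
  AllPairs (λ x y → Adjacent (proj₁ x) (proj₁ y) → ¬ Clash (proj₂ x) (proj₂ y))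
           (zipE σ cs)

countColored : List (Maybe ℕ) → ℕ
countColored []              = 0
countColored (just _ ∷ cs)   = suc (countColored cs)
countColored (nothing ∷ cs)  = countColored cs

ProperKColoring : ℕ → Input → List (Maybe ℕ) → Set
ProperKColoring k σ cs = length cs ≡ length σ × ValidColors k cs × Proper σ cs

IsOPT : ℕ → Input → ℕ → Set
IsOPT k σ n =
  (∃[ cs ] (ProperKColoring k σ cs × countColored cs ≡ n)) ×
  (∀ cs → ProperKColoring k σ cs → countColored cs ℕ.≤ n)

-- history: previously revealed edges with their color (nothing = rejected)
History : Set
History = List (Edge × Maybe ℕ)

incident : ℕ → Edge → Bool
incident x (u , v) = (x ≡ᵇ u) ∨ (x ≡ᵇ v)

isColor : Maybe ℕ → ℕ → Bool
isColor nothing  c = false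
isColor (just d) c = d ≡ᵇ c

isolated : History → Edge → Bool
isolated h (u , v) = not (any (λ x → incident u (proj₁ x) ∨ incident v (proj₁ x)) h)

usedAt : History → ℕ → ℕ → Bool
usedAt h x c = any (λ y → incident x (proj₁ y) ∧ isColor (proj₂ y) c) h

blocked : History → Edge → ℕ → Bool
blocked h (u , v) c = usedAt h u c ∨ usedAt h v c

greedy : History → Edge → Maybe ℕ
greedy h e =
  if not (blocked h e 1) then just 1
  else if not (blocked h e 2) then just 2
  else nothing

val : Maybe ℕ → ℚ
val (just _) = 1ℚ
val nothing  = 0ℚ

expRPFrom : ℚ → History → Input → ℚ
expRPFrom p h []      = 0ℚ
expRPFrom p h (e ∷ σ) =
  if isolated h e
  then p * (1ℚ + expRPFrom p ((e , just 1) ∷ h) σ)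
       + (1ℚ - p) * (1ℚ + expRPFrom p ((e , just 2) ∷ h) σ)
  else val (greedy h e) + expRPFrom p ((e , greedy h e) ∷ h) σ

expRP : ℚ → Input → ℚ
expRP p σ = expRPFrom p [] σ

CCompetitive : ℚ → ℚ → Set
CCompetitive p C =
  ∃[ b ] (∀ σ → IsPathInput σ → ∀ n → IsOPT 2 σ n →
            C * (+ n / 1) - b ≤ expRP p σ)

-- r is the supremum of all C for which RP_p is C-competitive
-- (it suffices to test rational C, since the set is downward closed)
CompetitiveRatio : ℚ → ℚ → Set
CompetitiveRatio p r =
  (∀ C → C < r → CCompetitive p C) × (∀ C → r < C → ¬ CCompetitive p C)

{-# OPTIONS --safe #-}
module Submission where

-- On a path, RP_p can only reject an edge whose two neighbours are already coloured
-- differently.  Renaming vertices, a path input becomes a sequence of distinct positions on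
-- the path 0 — 1 — 2 — ⋯.  Isolated edges, the seeds, get independent random colours, and a gap
-- of length d between two coloured edges is filled greedily and loses exactly one edge iff the
-- two colours disagree with the parity of d.  Between two seeds this happens with probability
-- 2p(1 − p) for even d and p² + (1 − p)² for odd d, which is at most ρ d for d ≥ 2, where
-- ρ = 1 − r and r = min {p² − p + 1, ⅔ (1 + p − p²)}.  Splitting the input at every seed then
-- gives E[RP_p(σ)] ≥ |σ| − ρ (|σ| + 1) ≥ r · OPT(σ) − 1.  Conversely, revealing the edges in
-- the orders 1, 3, 2, 5, 4, … and 1, 4, 2, 3, 7, 5, 6, … makes RP_p colour asymptotically only a
-- fraction p² − p + 1, respectively ⅔ (1 + p − p²), of the path.

open import Defs
open import Data.Integer using (+_)
open import Data.Rational using (ℚ; _+_; _*_; _-_; _≤_; _⊓_; 1ℚ; ½; _/_)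

open import Algebra.Bundles using (CommutativeMonoid)
open import Data.Bool using (Bool; true; false; not; _∧_; _∨_; _xor_; if_then_else_)
open import Data.Bool.Properties
  using (∨-commutativeMonoid; ∨-assoc; ∨-comm; ∨-identityʳ; ∨-zeroʳ; ∧-distribʳ-∨; xor-comm; not-involutive;
         not-distribˡ-xor; not-distribʳ-xor; ¬-not; T-≡; ⇔→≡)
open import Algebra.Properties.CommutativeSemigroup (CommutativeMonoid.commutativeSemigroup ∨-commutativeMonoid)
  using () renaming (interchange to ∨-interchange)
open import Data.Bool.ListAction using (any)
open import Data.Empty using (⊥-elim)
import Data.Integer as ℤ
import Data.Integer.Properties as ℤP
open import Data.List using (List; []; _∷_; _++_; length; map; filter)
open import Data.List.Properties using (filter-accept; filter-reject; length-filter; length-map)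
open import Data.List.Relation.Unary.All as All using (All; []; _∷_)
import Data.List.Relation.Unary.All.Properties as All
open import Data.List.Relation.Unary.AllPairs as AllPairs using ([]; _∷_)
import Data.List.Relation.Unary.AllPairs.Properties as AllPairs
open import Data.List.Relation.Unary.Unique.Propositional using (Unique)
import Data.List.Relation.Unary.Unique.Propositional.Properties as Unique
open import Data.List.Relation.Binary.Pointwise as Pointwise using (Pointwise; []; _∷_; Pointwise-length)
open import Data.List.Relation.Binary.Permutation.Propositional as ↭
  using (_↭_; ↭-sym; ↭-refl; ↭-prep; ↭-swap; ↭-trans; ↭⇒↭ₛ)
import Data.List.Relation.Binary.Permutation.Propositional.Properties as Perm
import Data.List.Relation.Binary.Permutation.Setoid.Properties as Permₛ
open import Data.Maybe using (Maybe; just; nothing)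
open import Data.Maybe.Properties using (just-injective)
open import Data.Nat as ℕ using (ℕ; zero; suc; _∸_; _≡ᵇ_; z≤n; s≤s)
import Data.Nat.Properties as ℕP
open import Data.Product using (_×_; _,_; proj₁; proj₂; Σ; ∃-syntax)
open import Data.Rational
  using (mkℚ; -_; 0ℚ; _<_; _≤?_; 1/_; toℚᵘ; NonNegative; nonNegative; Positive; positive)
open import Data.Rational.Properties
import Data.Rational.Unnormalised as ℚᵘ
import Data.Rational.Unnormalised.Properties as ℚᵘP
open import Data.Sum using (_⊎_; inj₁; inj₂; map₂)
open import Data.Unit using (⊤; tt)
open import Function using (_∘_; _⇔_; mk⇔; Equivalence)
open import Function.Properties.Equivalence using () renaming (trans to ⇔-trans; sym to ⇔-sym)
open import Relation.Binary.PropositionalEquality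
open import Relation.Nullary using (¬_; yes; no; ¬?)
open import Relation.Nullary.Decidable using (dec⇒maybe)
open import Tactic.RingSolver using (solve-∀)
open import Tactic.RingSolver.Core.AlmostCommutativeRing using (AlmostCommutativeRing; fromCommutativeRing)

-- Rationals and the expectation of a biased coin

ℚ-ring : AlmostCommutativeRing _ _
ℚ-ring = fromCommutativeRing +-*-commutativeRing (λ x → dec⇒maybe (0ℚ ≟ x))

fromℕ : ℕ → ℚ
fromℕ n = + n / 1

fromℕ-+ : ∀ m n → fromℕ (m ℕ.+ n) ≡ fromℕ m + fromℕ n
fromℕ-+ m n = toℚᵘ-injective (begin
  toℚᵘ (fromℕ (m ℕ.+ n))                         ≈⟨ toℚᵘ-fromℚᵘ (ℚᵘ.mkℚᵘ (+ (m ℕ.+ n)) 0) ⟩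
  ℚᵘ.mkℚᵘ (+ (m ℕ.+ n)) 0                        ≈⟨ ℚᵘ.*≡* (cong (ℤ._* + 1) (ℤ-sum m n)) ⟩
  ℚᵘ.mkℚᵘ (+ m) 0 ℚᵘ.+ ℚᵘ.mkℚᵘ (+ n) 0          ≈⟨ ℚᵘP.+-cong (ℚᵘP.≃-sym (toℚᵘ-fromℚᵘ (ℚᵘ.mkℚᵘ (+ m) 0))) (ℚᵘP.≃-sym (toℚᵘ-fromℚᵘ (ℚᵘ.mkℚᵘ (+ n) 0))) ⟩
  toℚᵘ (fromℕ m) ℚᵘ.+ toℚᵘ (fromℕ n)            ≈⟨ ℚᵘP.≃-sym (toℚᵘ-homo-+ (fromℕ m) (fromℕ n)) ⟩
  toℚᵘ (fromℕ m + fromℕ n)                       ∎)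
  where
  open ℚᵘP.≃-Reasoning
  ℤ-sum : ∀ m n → + (m ℕ.+ n) ≡ + m ℤ.* + 1 ℤ.+ + n ℤ.* + 1
  ℤ-sum m n = trans (ℤP.pos-+ m n) (sym (cong₂ ℤ._+_ (ℤP.*-identityʳ (+ m)) (ℤP.*-identityʳ (+ n))))

fromℕ-* : ∀ m n → fromℕ (m ℕ.* n) ≡ fromℕ m * fromℕ n
fromℕ-* m n = toℚᵘ-injective (begin
  toℚᵘ (fromℕ (m ℕ.* n))                         ≈⟨ toℚᵘ-fromℚᵘ (ℚᵘ.mkℚᵘ (+ (m ℕ.* n)) 0) ⟩
  ℚᵘ.mkℚᵘ (+ (m ℕ.* n)) 0                        ≈⟨ ℚᵘ.*≡* (cong (ℤ._* + 1) (ℤP.pos-* m n)) ⟩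
  ℚᵘ.mkℚᵘ (+ m) 0 ℚᵘ.* ℚᵘ.mkℚᵘ (+ n) 0          ≈⟨ ℚᵘP.*-cong (ℚᵘP.≃-sym (toℚᵘ-fromℚᵘ (ℚᵘ.mkℚᵘ (+ m) 0))) (ℚᵘP.≃-sym (toℚᵘ-fromℚᵘ (ℚᵘ.mkℚᵘ (+ n) 0))) ⟩
  toℚᵘ (fromℕ m) ℚᵘ.* toℚᵘ (fromℕ n)            ≈⟨ ℚᵘP.≃-sym (toℚᵘ-homo-* (fromℕ m) (fromℕ n)) ⟩
  toℚᵘ (fromℕ m * fromℕ n)                       ∎)
  where open ℚᵘP.≃-Reasoning

fromℕ-suc : ∀ n → fromℕ (suc n) ≡ 1ℚ + fromℕ n
fromℕ-suc = fromℕ-+ 1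

fromℕ-nonNeg : ∀ n → 0ℚ ≤ fromℕ n
fromℕ-nonNeg n = nonNegative⁻¹ (fromℕ n) {{normalize-nonNeg n 1}}

fromℕ-mono-≤ : ∀ {m n} → m ℕ.≤ n → fromℕ m ≤ fromℕ n
fromℕ-mono-≤ {m} {n} m≤n = begin
  fromℕ m                 ≡⟨ sym (+-identityʳ (fromℕ m)) ⟩
  fromℕ m + 0ℚ            ≤⟨ +-monoʳ-≤ (fromℕ m) (fromℕ-nonNeg (n ℕ.∸ m)) ⟩
  fromℕ m + fromℕ (n ℕ.∸ m) ≡⟨ sym (fromℕ-+ m (n ℕ.∸ m)) ⟩
  fromℕ (m ℕ.+ (n ℕ.∸ m))  ≡⟨ cong fromℕ (ℕP.m+[n∸m]≡n m≤n) ⟩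
  fromℕ n                 ∎
  where open ≤-Reasoning

fromℕ-unbounded : ∀ q → ∃[ m ] q < fromℕ m
fromℕ-unbounded q@(mkℚ (+ k) d _) = suc k , (begin-strict
  q              ≤⟨ q≤k ⟩
  fromℕ k        ≡⟨ sym (+-identityˡ (fromℕ k)) ⟩
  0ℚ + fromℕ k   <⟨ +-monoˡ-< (fromℕ k) (positive⁻¹ 1ℚ) ⟩
  1ℚ + fromℕ k   ≡⟨ sym (fromℕ-suc k) ⟩
  fromℕ (suc k)  ∎)
  where
  open ≤-Reasoning
  q≤k : q ≤ fromℕ k
  q≤k = toℚᵘ-cancel-≤ (ℚᵘP.≤-respʳ-≃ (ℚᵘP.≃-sym (toℚᵘ-fromℚᵘ (ℚᵘ.mkℚᵘ (+ k) 0)))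
          (ℚᵘ.*≤* (ℤP.*-monoˡ-≤-nonNeg (+ k) (ℤ.+≤+ (ℕ.s≤s ℕ.z≤n)))))
fromℕ-unbounded q@(mkℚ ℤ.-[1+ _ ] _ _) = 0 , negative⁻¹ q

archimedean : ∀ δ → 0ℚ < δ → ∀ K → ∃[ m ] K < δ * fromℕ m
archimedean δ 0<δ K = m , subst (_< δ * fromℕ m) δ[K/δ]≡K (*-monoʳ-<-pos δ K/δ<m)
  where
  instance
    δ-pos : Positive δ
    δ-pos = positive 0<δ
    δ-nonZero = pos⇒nonZero δ
  m = proj₁ (fromℕ-unbounded (K * 1/ δ))
  K/δ<m = proj₂ (fromℕ-unbounded (K * 1/ δ))
  δ[K/δ]≡K : δ * (K * 1/ δ) ≡ K
  δ[K/δ]≡K = begin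
    δ * (K * 1/ δ)   ≡⟨ sym (*-assoc δ K (1/ δ)) ⟩
    δ * K * 1/ δ     ≡⟨ cong (_* 1/ δ) (*-comm δ K) ⟩
    K * δ * 1/ δ     ≡⟨ *-assoc K δ (1/ δ) ⟩
    K * (δ * 1/ δ)   ≡⟨ cong (K *_) (*-inverseʳ δ) ⟩
    K * 1ℚ           ≡⟨ *-identityʳ K ⟩
    K                ∎
    where open ≡-Reasoning

*-nonNeg : ∀ {a b} → 0ℚ ≤ a → 0ℚ ≤ b → 0ℚ ≤ a * b
*-nonNeg {a} {b} 0≤a 0≤b = nonNegative⁻¹ (a * b) {{nonNeg*nonNeg⇒nonNeg a {{nonNegative 0≤a}} b {{nonNegative 0≤b}}}}

p≤q⇒0≤q-p : ∀ {p q} → p ≤ q → 0ℚ ≤ q - p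
p≤q⇒0≤q-p {p} {q} p≤q = subst (_≤ q - p) (+-inverseʳ p) (+-monoˡ-≤ (- p) p≤q)

𝔼 : ℚ → (Bool → ℚ) → ℚ
𝔼 p f = p * f true + (1ℚ - p) * f false

𝔼-cong : ∀ p {f g} → (∀ c → f c ≡ g c) → 𝔼 p f ≡ 𝔼 p g
𝔼-cong p f≗g = cong₂ (λ a b → p * a + (1ℚ - p) * b) (f≗g true) (f≗g false)

𝔼-const : ∀ p k → 𝔼 p (λ _ → k) ≡ k
𝔼-const = lemma
  where
  lemma : ∀ p k → p * k + (1ℚ - p) * k ≡ k
  lemma = solve-∀ ℚ-ring

𝔼-+ : ∀ p f g → 𝔼 p (λ c → f c + g c) ≡ 𝔼 p f + 𝔼 p g
𝔼-+ p f g = lemma p (f true) (f false) (g true) (g false)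
  where
  lemma : ∀ p a b c d → p * (a + c) + (1ℚ - p) * (b + d) ≡ (p * a + (1ℚ - p) * b) + (p * c + (1ℚ - p) * d)
  lemma = solve-∀ ℚ-ring

𝔼-shift : ∀ p K g → 𝔼 p (λ c → K + g c) ≡ K + 𝔼 p g
𝔼-shift p K g = lemma p K (g true) (g false)
  where
  lemma : ∀ p K a b → p * (K + a) + (1ℚ - p) * (K + b) ≡ K + (p * a + (1ℚ - p) * b)
  lemma = solve-∀ ℚ-ring

𝔼-mono-≤ : ∀ {p} → 0ℚ ≤ p → p ≤ 1ℚ → ∀ {f g} → (∀ c → f c ≤ g c) → 𝔼 p f ≤ 𝔼 p g
𝔼-mono-≤ {p} 0≤p p≤1 f≤g = +-mono-≤
  (*-monoˡ-≤-nonNeg p {{nonNegative 0≤p}} (f≤g true))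
  (*-monoˡ-≤-nonNeg (1ℚ - p) {{nonNegative (p≤q⇒0≤q-p p≤1)}} (f≤g false))

fromBool : Bool → ℚ
fromBool true  = 1ℚ
fromBool false = 0ℚ

fromBool-nonNeg : ∀ b → 0ℚ ≤ fromBool b
fromBool-nonNeg true  = <⇒≤ (positive⁻¹ 1ℚ)
fromBool-nonNeg false = ≤-refl

-- mismatch x z d: edges at distance d coloured x and z (true standing for colour 1) do not fit
-- one alternating colouring, so greedily filling the gap between them rejects one edge.
mismatch : Bool → Bool → ℕ → Bool
mismatch x z zero    = x xor z
mismatch x z (suc d) = mismatch (not x) z d

mismatch-sucʳ : ∀ x z d → mismatch x (not z) d ≡ mismatch x z (suc d)
mismatch-sucʳ x z zero    = trans (sym (not-distribʳ-xor x z)) (not-distribˡ-xor x z)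
mismatch-sucʳ x z (suc d) = mismatch-sucʳ (not x) z d

mismatch-comm : ∀ x z d → mismatch x z d ≡ mismatch z x d
mismatch-comm x z zero    = xor-comm x z
mismatch-comm x z (suc d) = trans (mismatch-comm (not x) z d) (mismatch-sucʳ z x d)

mismatch-+2 : ∀ x z d → mismatch x z (suc (suc d)) ≡ mismatch x z d
mismatch-+2 x z d = cong (λ x′ → mismatch x′ z d) (not-involutive x)

mismatchRate : ℚ → Bool → ℕ → ℚ
mismatchRate p x d = 𝔼 p (λ z → fromBool (mismatch x z d))

≡ᵇ⇔≡ : ∀ m n → (m ≡ᵇ n) ≡ true ⇔ m ≡ n
≡ᵇ⇔≡ m n = mk⇔ (ℕP.≡ᵇ⇒≡ m n ∘ Equivalence.from T-≡) (Equivalence.to T-≡ ∘ ℕP.≡⇒≡ᵇ m n)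

≡ᵇ-refl : ∀ n → (n ≡ᵇ n) ≡ true
≡ᵇ-refl n = Equivalence.from (≡ᵇ⇔≡ n n) refl

≢⇒≡ᵇ-false : ∀ {m n} → m ≢ n → (m ≡ᵇ n) ≡ false
≢⇒≡ᵇ-false {m} {n} m≢n = ¬-not (m≢n ∘ Equivalence.to (≡ᵇ⇔≡ m n))

≡ᵇ-cong-⇔ : ∀ {a b c d} → a ≡ b ⇔ c ≡ d → (a ≡ᵇ b) ≡ (c ≡ᵇ d)
≡ᵇ-cong-⇔ {a} {b} {c} {d} a≡b⇔c≡d =
  ⇔→≡ (⇔-trans (≡ᵇ⇔≡ a b) (⇔-trans a≡b⇔c≡d (⇔-sym (≡ᵇ⇔≡ c d))))

∨-repeat : ∀ a b c → (b ∨ a) ∨ (c ∨ b) ≡ (a ∨ b) ∨ c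
∨-repeat false false false = refl
∨-repeat false false true  = refl
∨-repeat false true  _     = refl
∨-repeat true  false false = refl
∨-repeat true  false true  = refl
∨-repeat true  true  _     = refl

module _ {A : Set} where

  any-cong : ∀ {f g : A → Bool} xs → (∀ x → f x ≡ g x) → any f xs ≡ any g xs
  any-cong []       f≗g = refl
  any-cong (x ∷ xs) f≗g = cong₂ _∨_ (f≗g x) (any-cong xs f≗g)

  any-∨ : ∀ (f g : A → Bool) xs → any (λ x → f x ∨ g x) xs ≡ any f xs ∨ any g xs
  any-∨ f g []       = refl
  any-∨ f g (x ∷ xs) =
    trans (cong ((f x ∨ g x) ∨_) (any-∨ f g xs)) (∨-interchange (f x) (g x) (any f xs) (any g xs))

  any-++ : ∀ (f : A → Bool) xs ys → any f (xs ++ ys) ≡ any f xs ∨ any f ys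
  any-++ f []       ys = refl
  any-++ f (x ∷ xs) ys = trans (cong (f x ∨_) (any-++ f xs ys)) (sym (∨-assoc (f x) (any f xs) (any f ys)))

any-Pointwise : ∀ {A B : Set} {R : A → B → Set} (f : A → Bool) (g : B → Bool) {xs ys} →
  (∀ {x y} → R x y → f x ≡ g y) → Pointwise R xs ys → any f xs ≡ any g ys
any-Pointwise f g f≈g []         = refl
any-Pointwise f g f≈g (r ∷ rs)   = cong₂ _∨_ (f≈g r) (any-Pointwise f g f≈g rs)

colour : Bool → ℕ
colour true  = 1
colour false = 2

-- RP_p on positions of a path

touches : Edge → Edge → Bool
touches (u , v) e = incident u e ∨ incident v e

-- Position i stands for the edge (i ∸ 1 , i) of the path 0 — 1 — 2 — ⋯, so two positions are
-- adjacent iff they differ by at most one.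
Historyᵢ : Set
Historyᵢ = List (ℕ × Maybe ℕ)

adjacentᵢ : ℕ → ℕ → Bool
adjacentᵢ i j = touches (i , suc i) (j , suc j)

isolatedᵢ : Historyᵢ → ℕ → Bool
isolatedᵢ h i = not (any (λ y → adjacentᵢ i (proj₁ y)) h)

blockedᵢ : Historyᵢ → ℕ → ℕ → Bool
blockedᵢ h i c = any (λ y → adjacentᵢ i (proj₁ y) ∧ isColor (proj₂ y) c) h

greedyᵢ : Historyᵢ → ℕ → Maybe ℕ
greedyᵢ h i =
  if not (blockedᵢ h i 1) then just 1
  else if not (blockedᵢ h i 2) then just 2
  else nothing

stepᵢ : ℚ → Historyᵢ → ℕ → (Maybe ℕ → ℚ) → ℚ
stepᵢ p h i k =
  if isolatedᵢ h i
  then 𝔼 p (λ c → 1ℚ + k (just (colour c)))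
  else val (greedyᵢ h i) + k (greedyᵢ h i)

expᵢ : ℚ → Historyᵢ → List ℕ → ℚ
expᵢ p h []      = 0ℚ
expᵢ p h (i ∷ σ) = stepᵢ p h i (λ m → expᵢ p ((i , m) ∷ h) σ)

module _ (p : ℚ) (h : Historyᵢ) (i : ℕ) where

  stepᵢ-+ʳ : ∀ k K → stepᵢ p h i (λ m → k m + K) ≡ stepᵢ p h i k + K
  stepᵢ-+ʳ k K with isolatedᵢ h i
  ... | true  = lemma p (k (just 1)) (k (just 2)) K
    where
    lemma : ∀ p x y K → p * (1ℚ + (x + K)) + (1ℚ - p) * (1ℚ + (y + K)) ≡ (p * (1ℚ + x) + (1ℚ - p) * (1ℚ + y)) + K
    lemma = solve-∀ ℚ-ring
  ... | false = sym (+-assoc (val (greedyᵢ h i)) (k (greedyᵢ h i)) K)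

  stepᵢ-+ˡ : ∀ K k → stepᵢ p h i (λ m → K + k m) ≡ K + stepᵢ p h i k
  stepᵢ-+ˡ K k with isolatedᵢ h i
  ... | true  = lemma p (k (just 1)) (k (just 2)) K
    where
    lemma : ∀ p x y K → p * (1ℚ + (K + x)) + (1ℚ - p) * (1ℚ + (K + y)) ≡ K + (p * (1ℚ + x) + (1ℚ - p) * (1ℚ + y))
    lemma = solve-∀ ℚ-ring
  ... | false = lemma (val (greedyᵢ h i)) K (k (greedyᵢ h i))
    where
    lemma : ∀ v K x → v + (K + x) ≡ K + (v + x)
    lemma = solve-∀ ℚ-ring

stepᵢ-cong : ∀ p h h′ i {k k′} → isolatedᵢ h i ≡ isolatedᵢ h′ i → greedyᵢ h i ≡ greedyᵢ h′ i →
  (∀ m → k m ≡ k′ m) → stepᵢ p h i k ≡ stepᵢ p h′ i k′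
stepᵢ-cong p h h′ i {k} {k′} iso≡ greedy≡ k≗k′ rewrite iso≡ | greedy≡ with isolatedᵢ h′ i
... | true  = 𝔼-cong p (λ c → cong (λ x → 1ℚ + x) (k≗k′ (just (colour c))))
... | false = cong (λ x → val (greedyᵢ h′ i) + x) (k≗k′ (greedyᵢ h′ i))

revealedᵢ : Historyᵢ → ℕ → Bool
revealedᵢ h k = any (λ y → k ≡ᵇ proj₁ y) h

colouredᵢ : Historyᵢ → ℕ → ℕ → Bool
colouredᵢ h k c = any (λ y → (k ≡ᵇ proj₁ y) ∧ isColor (proj₂ y) c) h

adjacentᵢ-suc : ∀ i j → adjacentᵢ (suc i) j ≡ ((i ≡ᵇ j) ∨ (suc i ≡ᵇ j)) ∨ (suc (suc i) ≡ᵇ j)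
adjacentᵢ-suc i j = ∨-repeat (i ≡ᵇ j) (suc i ≡ᵇ j) (suc (suc i) ≡ᵇ j)

any-∨₃ : ∀ {A : Set} (f g k : A → Bool) xs → any (λ x → (f x ∨ g x) ∨ k x) xs ≡ (any f xs ∨ any g xs) ∨ any k xs
any-∨₃ f g k xs = trans (any-∨ (λ x → f x ∨ g x) k xs) (cong (_∨ any k xs) (any-∨ f g xs))

isolatedᵢ-suc : ∀ h i → isolatedᵢ h (suc i) ≡ not ((revealedᵢ h i ∨ revealedᵢ h (suc i)) ∨ revealedᵢ h (suc (suc i)))
isolatedᵢ-suc h i = cong not (trans (any-cong h (λ y → adjacentᵢ-suc i (proj₁ y)))
  (any-∨₃ (λ y → i ≡ᵇ proj₁ y) (λ y → suc i ≡ᵇ proj₁ y) (λ y → suc (suc i) ≡ᵇ proj₁ y) h))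

blockedᵢ-suc : ∀ h i c → blockedᵢ h (suc i) c ≡ (colouredᵢ h i c ∨ colouredᵢ h (suc i) c) ∨ colouredᵢ h (suc (suc i)) c
blockedᵢ-suc h i c = trans (any-cong h distrib)
  (any-∨₃ (λ y → (i ≡ᵇ proj₁ y) ∧ isColor (proj₂ y) c) (λ y → (suc i ≡ᵇ proj₁ y) ∧ isColor (proj₂ y) c)
          (λ y → (suc (suc i) ≡ᵇ proj₁ y) ∧ isColor (proj₂ y) c) h)
  where
  distrib : ∀ y → adjacentᵢ (suc i) (proj₁ y) ∧ isColor (proj₂ y) c ≡ _
  distrib (j , m) = let K = isColor m c in begin
    adjacentᵢ (suc i) j ∧ K                                         ≡⟨ cong (_∧ K) (adjacentᵢ-suc i j) ⟩
    (((i ≡ᵇ j) ∨ (suc i ≡ᵇ j)) ∨ (suc (suc i) ≡ᵇ j)) ∧ K            ≡⟨ ∧-distribʳ-∨ K ((i ≡ᵇ j) ∨ (suc i ≡ᵇ j)) (suc (suc i) ≡ᵇ j) ⟩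
    (((i ≡ᵇ j) ∨ (suc i ≡ᵇ j)) ∧ K) ∨ ((suc (suc i) ≡ᵇ j) ∧ K)      ≡⟨ cong (_∨ ((suc (suc i) ≡ᵇ j) ∧ K)) (∧-distribʳ-∨ K (i ≡ᵇ j) (suc i ≡ᵇ j)) ⟩
    (((i ≡ᵇ j) ∧ K) ∨ ((suc i ≡ᵇ j) ∧ K)) ∨ ((suc (suc i) ≡ᵇ j) ∧ K) ∎
    where open ≡-Reasoning

unrevealed⇒uncoloured : ∀ h k c → revealedᵢ h k ≡ false → colouredᵢ h k c ≡ false
unrevealed⇒uncoloured []            k c _   = refl
unrevealed⇒uncoloured ((j , m) ∷ h) k c unr with k ≡ᵇ j
... | false = unrevealed⇒uncoloured h k c unr

greedyᵢ-cong : ∀ h h′ i → blockedᵢ h i 1 ≡ blockedᵢ h′ i 1 → blockedᵢ h i 2 ≡ blockedᵢ h′ i 2 →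
  greedyᵢ h i ≡ greedyᵢ h′ i
greedyᵢ-cong h h′ i b₁ b₂ = cong₂ (λ b₁ b₂ → if not b₁ then just 1 else if not b₂ then just 2 else nothing) b₁ b₂

FarApart : ℕ → ℕ → Set
FarApart j k = suc j ℕ.< k ⊎ suc k ℕ.< j

adjacentᵢ-false : ∀ {j k} → j ≢ k → j ≢ suc k → suc j ≢ k → adjacentᵢ j k ≡ false
adjacentᵢ-false j≢k j≢1+k 1+j≢k
  rewrite ≢⇒≡ᵇ-false j≢k | ≢⇒≡ᵇ-false j≢1+k | ≢⇒≡ᵇ-false 1+j≢k = refl

adjacentᵢ-far : ∀ {j k} → FarApart j k → adjacentᵢ j k ≡ false
adjacentᵢ-far {j} {k} (inj₁ 1+j<k) = adjacentᵢ-false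
  (ℕP.<⇒≢ (ℕP.<-trans (ℕP.n<1+n j) 1+j<k)) (ℕP.<⇒≢ (ℕP.<-trans (ℕP.n<1+n j) (ℕP.m<n⇒m<1+n 1+j<k))) (ℕP.<⇒≢ 1+j<k)
adjacentᵢ-far {j} {k} (inj₂ 1+k<j) = adjacentᵢ-false
  (ℕP.>⇒≢ (ℕP.<-trans (ℕP.n<1+n k) 1+k<j)) (ℕP.>⇒≢ 1+k<j) (ℕP.>⇒≢ (ℕP.<-trans (ℕP.n<1+n k) (ℕP.m<n⇒m<1+n 1+k<j)))

expᵢ-forget : ∀ p h₁ x h₂ σ → All (λ j → adjacentᵢ j (proj₁ x) ≡ false) σ →
  expᵢ p (h₁ ++ x ∷ h₂) σ ≡ expᵢ p (h₁ ++ h₂) σ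
expᵢ-forget p h₁ x h₂ []      _         = refl
expᵢ-forget p h₁ x h₂ (j ∷ σ) (x≁j ∷ x≁σ) =
  stepᵢ-cong p (h₁ ++ x ∷ h₂) (h₁ ++ h₂) j (cong not (drop _ x≁j)) (greedyᵢ-cong (h₁ ++ x ∷ h₂) (h₁ ++ h₂) j (drop _ (cong (_∧ _) x≁j)) (drop _ (cong (_∧ _) x≁j)))
    (λ m → expᵢ-forget p ((j , m) ∷ h₁) x h₂ σ x≁σ)
  where
  drop : ∀ (f : ℕ × Maybe ℕ → Bool) → f x ≡ false → any f (h₁ ++ x ∷ h₂) ≡ any f (h₁ ++ h₂)
  drop f fx≡false = begin
    any f (h₁ ++ x ∷ h₂)          ≡⟨ any-++ f h₁ (x ∷ h₂) ⟩
    any f h₁ ∨ (f x ∨ any f h₂)   ≡⟨ cong (λ b → any f h₁ ∨ (b ∨ any f h₂)) fx≡false ⟩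
    any f h₁ ∨ any f h₂           ≡⟨ sym (any-++ f h₁ h₂) ⟩
    any f (h₁ ++ h₂)              ∎
    where open ≡-Reasoning

below above : ℕ → List ℕ → List ℕ
below e = filter (ℕ._<? e)
above e = filter (λ j → ¬? (j ℕ.<? e))

below-< : ∀ e σ → All (ℕ._< e) (below e σ)
below-< e = All.all-filter (ℕ._<? e)

above-> : ∀ e {σ} → All (_≢ e) σ → All (e ℕ.<_) (above e σ)
above-> e {σ} σ≢e = All.zipWith (λ (e≮j , j≢e) → ℕP.≤∧≢⇒< (ℕP.≮⇒≥ e≮j) (j≢e ∘ sym))
  (All.all-filter (λ j → ¬? (j ℕ.<? e)) σ , All.filter⁺ (λ j → ¬? (j ℕ.<? e)) σ≢e)

length-below-above : ∀ e σ → length σ ≡ length (below e σ) ℕ.+ length (above e σ)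
length-below-above e [] = refl
length-below-above e (j ∷ σ) with j ℕ.<? e
... | yes j<e rewrite filter-accept (ℕ._<? e) {x = j} {xs = σ} j<e
                    | filter-reject (λ j → ¬? (j ℕ.<? e)) {x = j} {xs = σ} (λ j≮e → j≮e j<e)
  = cong suc (length-below-above e σ)
... | no j≮e rewrite filter-reject (ℕ._<? e) {x = j} {xs = σ} j≮e
                   | filter-accept (λ j → ¬? (j ℕ.<? e)) {x = j} {xs = σ} j≮e
  = trans (cong suc (length-below-above e σ)) (sym (ℕP.+-suc (length (below e σ)) (length (above e σ))))

module _ (p : ℚ) (σ σL σR : List ℕ) (split : ∀ h → expᵢ p h σ ≡ expᵢ p h σL + expᵢ p h σR) (h : Historyᵢ) (j : ℕ) where

  expᵢ-∷-splitˡ : All (λ k → adjacentᵢ k j ≡ false) σR → expᵢ p h (j ∷ σ) ≡ expᵢ p h (j ∷ σL) + expᵢ p h σR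
  expᵢ-∷-splitˡ j≁σR = begin
    stepᵢ p h j (λ m → expᵢ p ((j , m) ∷ h) σ)
      ≡⟨ stepᵢ-cong p h h j refl refl (λ m → trans (split ((j , m) ∷ h))
           (cong (λ x → expᵢ p ((j , m) ∷ h) σL + x) (expᵢ-forget p [] (j , m) h σR j≁σR))) ⟩
    stepᵢ p h j (λ m → expᵢ p ((j , m) ∷ h) σL + expᵢ p h σR)
      ≡⟨ stepᵢ-+ʳ p h j (λ m → expᵢ p ((j , m) ∷ h) σL) (expᵢ p h σR) ⟩
    stepᵢ p h j (λ m → expᵢ p ((j , m) ∷ h) σL) + expᵢ p h σR ∎
    where open ≡-Reasoning

  expᵢ-∷-splitʳ : All (λ k → adjacentᵢ k j ≡ false) σL → expᵢ p h (j ∷ σ) ≡ expᵢ p h σL + expᵢ p h (j ∷ σR)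
  expᵢ-∷-splitʳ j≁σL = begin
    stepᵢ p h j (λ m → expᵢ p ((j , m) ∷ h) σ)
      ≡⟨ stepᵢ-cong p h h j refl refl (λ m → trans (split ((j , m) ∷ h))
           (cong (_+ expᵢ p ((j , m) ∷ h) σR) (expᵢ-forget p [] (j , m) h σL j≁σL))) ⟩
    stepᵢ p h j (λ m → expᵢ p h σL + expᵢ p ((j , m) ∷ h) σR)
      ≡⟨ stepᵢ-+ˡ p h j (expᵢ p h σL) (λ m → expᵢ p ((j , m) ∷ h) σR) ⟩
    expᵢ p h σL + stepᵢ p h j (λ m → expᵢ p ((j , m) ∷ h) σR) ∎
    where open ≡-Reasoning

expᵢ-split : ∀ p e h σ → All (_≢ e) σ → expᵢ p h σ ≡ expᵢ p h (below e σ) + expᵢ p h (above e σ)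
expᵢ-split p e h []      _            = sym (+-identityʳ 0ℚ)
expᵢ-split p e h (j ∷ σ) (j≢e ∷ σ≢e) with j ℕ.<? e
... | yes j<e
  rewrite filter-accept (ℕ._<? e) {x = j} {xs = σ} j<e
        | filter-reject (λ j → ¬? (j ℕ.<? e)) {x = j} {xs = σ} (λ j≮e → j≮e j<e)
  = expᵢ-∷-splitˡ p σ (below e σ) (above e σ) (λ h′ → expᵢ-split p e h′ σ σ≢e) h j
      (All.map (λ e<k → adjacentᵢ-far (inj₂ (ℕP.<-≤-trans (s≤s j<e) e<k))) (above-> e σ≢e))
... | no j≮e
  rewrite filter-reject (ℕ._<? e) {x = j} {xs = σ} j≮e
        | filter-accept (λ j → ¬? (j ℕ.<? e)) {x = j} {xs = σ} j≮e
  = expᵢ-∷-splitʳ p σ (below e σ) (above e σ) (λ h′ → expᵢ-split p e h′ σ σ≢e) h j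
      (All.map (λ k<e → adjacentᵢ-far (inj₁ (ℕP.<-≤-trans (s≤s k<e) e<j))) (below-< e σ))
  where
  e<j : e ℕ.< j
  e<j = ℕP.≤∧≢⇒< (ℕP.≮⇒≥ j≮e) (j≢e ∘ sym)

module _ (p : ℚ) (h : Historyᵢ) (i : ℕ) (σ : List ℕ) where

  expᵢ-isolated : isolatedᵢ h i ≡ true → expᵢ p h (i ∷ σ) ≡ 𝔼 p (λ c → 1ℚ + expᵢ p ((i , just (colour c)) ∷ h) σ)
  expᵢ-isolated iso rewrite iso = refl

  expᵢ-greedy : isolatedᵢ h i ≡ false → expᵢ p h (i ∷ σ) ≡ val (greedyᵢ h i) + expᵢ p ((i , greedyᵢ h i) ∷ h) σ
  expᵢ-greedy iso rewrite iso = refl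

  expᵢ-extend : ∀ {c} → isolatedᵢ h i ≡ false → greedyᵢ h i ≡ just c → expᵢ p h (i ∷ σ) ≡ 1ℚ + expᵢ p ((i , just c) ∷ h) σ
  expᵢ-extend iso greedy = trans (expᵢ-greedy iso) (cong (λ g → val g + expᵢ p ((i , g) ∷ h) σ) greedy)

-- Gaps between revealed edges

-- A gap is a run of unrevealed positions strictly between two ends a and b; an end is either
-- unrevealed itself or an edge coloured x.
data End : Set where
  free coloured : End

EndState : End → Historyᵢ → ℕ → Bool → Set
EndState free     h a x = revealedᵢ h a ≡ false
EndState coloured h a x = colouredᵢ h a (colour x) ≡ true × colouredᵢ h a (colour (not x)) ≡ false

revealedᵢ-∷ : ∀ h {e} m {k} → k ≢ e → revealedᵢ h k ≡ false → revealedᵢ ((e , m) ∷ h) k ≡ false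
revealedᵢ-∷ h m k≢e unr rewrite ≢⇒≡ᵇ-false k≢e = unr

EndState-∷ : ∀ s h {e} m {a x} → a ≢ e → EndState s h a x → EndState s ((e , m) ∷ h) a x
EndState-∷ free     h m a≢e st rewrite ≢⇒≡ᵇ-false a≢e = st
EndState-∷ coloured h m a≢e st rewrite ≢⇒≡ᵇ-false a≢e = st

EndState-new : ∀ h e c → revealedᵢ h e ≡ false → EndState coloured ((e , just (colour c)) ∷ h) e c
EndState-new h e true  unr rewrite ≡ᵇ-refl e = refl , unrevealed⇒uncoloured h e 2 unr
EndState-new h e false unr rewrite ≡ᵇ-refl e = refl , unrevealed⇒uncoloured h e 1 unr

coloured⇒revealed : ∀ h k c → colouredᵢ h k c ≡ true → revealedᵢ h k ≡ true
coloured⇒revealed h k c col with revealedᵢ h k in unr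
... | true  = refl
... | false = trans (sym (unrevealed⇒uncoloured h k c unr)) col

EndState⇒revealed : ∀ h a x → EndState coloured h a x → revealedᵢ h a ≡ true
EndState⇒revealed h a x (col , _) = coloured⇒revealed h a (colour x) col

isolatedᵢ-true : ∀ h i → revealedᵢ h i ≡ false → revealedᵢ h (suc i) ≡ false → revealedᵢ h (suc (suc i)) ≡ false →
  isolatedᵢ h (suc i) ≡ true
isolatedᵢ-true h i u₀ u₁ u₂ rewrite isolatedᵢ-suc h i | u₀ | u₁ | u₂ = refl

isolatedᵢ-falseˡ : ∀ h i → revealedᵢ h i ≡ true → isolatedᵢ h (suc i) ≡ false
isolatedᵢ-falseˡ h i r rewrite isolatedᵢ-suc h i | r = refl

isolatedᵢ-falseʳ : ∀ h i → revealedᵢ h (suc (suc i)) ≡ true → isolatedᵢ h (suc i) ≡ false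
isolatedᵢ-falseʳ h i r rewrite isolatedᵢ-suc h i | r | ∨-zeroʳ (revealedᵢ h i ∨ revealedᵢ h (suc i)) = refl

module _ (h : Historyᵢ) (a : ℕ) (u₁ : revealedᵢ h (suc a) ≡ false) (c : ℕ) where

  private
    between : blockedᵢ h (suc a) c ≡ colouredᵢ h a c ∨ colouredᵢ h (suc (suc a)) c
    between rewrite blockedᵢ-suc h a c | unrevealed⇒uncoloured h (suc a) c u₁
      = cong (_∨ colouredᵢ h (suc (suc a)) c) (∨-identityʳ (colouredᵢ h a c))

  blockedᵢ-byˡ : colouredᵢ h a c ≡ true → blockedᵢ h (suc a) c ≡ true
  blockedᵢ-byˡ col rewrite between | col = refl

  blockedᵢ-byʳ : colouredᵢ h (suc (suc a)) c ≡ true → blockedᵢ h (suc a) c ≡ true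
  blockedᵢ-byʳ col rewrite between | col = ∨-zeroʳ (colouredᵢ h a c)

  blockedᵢ-free : colouredᵢ h a c ≡ false → colouredᵢ h (suc (suc a)) c ≡ false → blockedᵢ h (suc a) c ≡ false
  blockedᵢ-free unc₀ unc₂ rewrite between | unc₀ | unc₂ = refl

greedyᵢ-other : ∀ h i x → blockedᵢ h i (colour x) ≡ true → blockedᵢ h i (colour (not x)) ≡ false →
  greedyᵢ h i ≡ just (colour (not x))
greedyᵢ-other h i true  b₁ b₂ rewrite b₁ | b₂ = refl
greedyᵢ-other h i false b₂ b₁ rewrite b₁ = refl

greedyᵢ-reject : ∀ h i → blockedᵢ h i 1 ≡ true → blockedᵢ h i 2 ≡ true → greedyᵢ h i ≡ nothing
greedyᵢ-reject h i b₁ b₂ rewrite b₁ | b₂ = refl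

greedyᵢ-extendˡ : ∀ h a x → EndState coloured h a x → revealedᵢ h (suc a) ≡ false → revealedᵢ h (suc (suc a)) ≡ false →
  greedyᵢ h (suc a) ≡ just (colour (not x))
greedyᵢ-extendˡ h a x (col , uncol) u₁ u₂ = greedyᵢ-other h (suc a) x
  (blockedᵢ-byˡ h a u₁ (colour x) col)
  (blockedᵢ-free h a u₁ (colour (not x)) uncol (unrevealed⇒uncoloured h (suc (suc a)) (colour (not x)) u₂))

greedyᵢ-extendʳ : ∀ h a y → EndState coloured h (suc (suc a)) y → revealedᵢ h a ≡ false → revealedᵢ h (suc a) ≡ false →
  greedyᵢ h (suc a) ≡ just (colour (not y))
greedyᵢ-extendʳ h a y (col , uncol) u₀ u₁ = greedyᵢ-other h (suc a) y
  (blockedᵢ-byʳ h a u₁ (colour y) col)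
  (blockedᵢ-free h a u₁ (colour (not y)) (unrevealed⇒uncoloured h a (colour (not y)) u₀) uncol)

greedyᵢ-bridge : ∀ h a x y → EndState coloured h a x → EndState coloured h (suc (suc a)) y → revealedᵢ h (suc a) ≡ false →
  val (greedyᵢ h (suc a)) ≡ 1ℚ - fromBool (mismatch x y 2)
greedyᵢ-bridge h a true true (col , uncol) (_ , uncol′) u₁
  rewrite greedyᵢ-other h (suc a) true (blockedᵢ-byˡ h a u₁ 1 col) (blockedᵢ-free h a u₁ 2 uncol uncol′) = refl
greedyᵢ-bridge h a false false (col , uncol) (_ , uncol′) u₁
  rewrite greedyᵢ-other h (suc a) false (blockedᵢ-byˡ h a u₁ 2 col) (blockedᵢ-free h a u₁ 1 uncol uncol′) = refl
greedyᵢ-bridge h a true false (col , _) (col′ , _) u₁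
  rewrite greedyᵢ-reject h (suc a) (blockedᵢ-byˡ h a u₁ 1 col) (blockedᵢ-byʳ h a u₁ 2 col′) = refl
greedyᵢ-bridge h a false true (col , _) (col′ , _) u₁
  rewrite greedyᵢ-reject h (suc a) (blockedᵢ-byʳ h a u₁ 1 col′) (blockedᵢ-byˡ h a u₁ 2 col) = refl

expᵢ-bridge : ∀ p h a x y σ → EndState coloured h a x → EndState coloured h (suc (suc a)) y → revealedᵢ h (suc a) ≡ false →
  expᵢ p h (suc a ∷ σ) ≡ (1ℚ - fromBool (mismatch x y 2)) + expᵢ p ((suc a , greedyᵢ h (suc a)) ∷ h) σ
expᵢ-bridge p h a x y σ stˣ stʸ u₁ =
  trans (expᵢ-greedy p h (suc a) σ (isolatedᵢ-falseˡ h a (EndState⇒revealed h a x stˣ)))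
    (cong (_+ expᵢ p ((suc a , greedyᵢ h (suc a)) ∷ h) σ) (greedyᵢ-bridge h a x y stˣ stʸ u₁))

∸-split : ∀ {a e b} → a ℕ.≤ e → e ℕ.≤ b → b ∸ a ≡ (e ∸ a) ℕ.+ (b ∸ e)
∸-split {a} {e} {b} a≤e e≤b = trans (cong (_∸ a) (sym (ℕP.m+[n∸m]≡n e≤b))) (ℕP.+-∸-comm (b ∸ e) a≤e)

Inside : ℕ → ℕ → List ℕ → Set
Inside a b = All (λ j → a ℕ.< j × j ℕ.< b)

Inside-below : ∀ e {a b σ} → Inside a b σ → Inside a e (below e σ)
Inside-below e {σ = σ} inside = All.zipWith (λ ((a<j , _) , j<e) → a<j , j<e) (All.filter⁺ (ℕ._<? e) inside , below-< e σ)

Inside-above : ∀ e {a b σ} → All (_≢ e) σ → Inside a b σ → Inside e b (above e σ)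
Inside-above e σ≢e inside =
  All.zipWith (λ (e<j , (_ , j<b)) → e<j , j<b) (above-> e σ≢e , All.filter⁺ (λ j → ¬? (j ℕ.<? e)) inside)

GapState : End → ℕ → Bool → End → ℕ → Bool → Historyᵢ → Set
GapState l a x r b y h =
  EndState l h a x × EndState r h b y × (∀ k → a ℕ.< k → k ℕ.< b → revealedᵢ h k ≡ false)

Apart : End → ℕ → ℕ → Set
Apart l i j = l ≡ free ⊎ suc i ≢ j

unrevealed-beside : ∀ l h a x k → EndState l h a x → l ≡ free ⊎ k ≢ a → (k ≢ a → revealedᵢ h k ≡ false) →
  revealedᵢ h k ≡ false
unrevealed-beside l    h a x k st (inj₂ k≢a)  inside = inside k≢a
unrevealed-beside free h a x k st (inj₁ refl) inside with k ℕ.≟ a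
... | yes refl = st
... | no k≢a   = inside k≢a

apart? : ∀ l i j → Apart l i j ⊎ (l ≡ coloured × suc i ≡ j)
apart? free     i j = inj₁ (inj₁ refl)
apart? coloured i j with suc i ℕ.≟ j
... | yes i+1≡j = inj₂ (refl , i+1≡j)
... | no  i+1≢j = inj₁ (inj₂ i+1≢j)

module _ {l a x r b y h} (st : GapState l a x r b y h) where

  private
    stˡ = proj₁ st
    stʳ = proj₁ (proj₂ st)
    interior = proj₂ (proj₂ st)

  GapState-seedˡ : ∀ {e} → a ℕ.< e → e ℕ.< b → ∀ c → GapState l a x coloured e c ((e , just (colour c)) ∷ h)
  GapState-seedˡ {e} a<e e<b c =
      EndState-∷ l h (just (colour c)) (ℕP.<⇒≢ a<e) stˡ
    , EndState-new h e c (interior e a<e e<b)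
    , λ k a<k k<e → revealedᵢ-∷ h (just (colour c)) (ℕP.<⇒≢ k<e) (interior k a<k (ℕP.<-trans k<e e<b))

  GapState-seedʳ : ∀ {e} → a ℕ.< e → e ℕ.< b → ∀ c → GapState coloured e c r b y ((e , just (colour c)) ∷ h)
  GapState-seedʳ {e} a<e e<b c =
      EndState-new h e c (interior e a<e e<b)
    , EndState-∷ r h (just (colour c)) (ℕP.>⇒≢ e<b) stʳ
    , λ k e<k k<b → revealedᵢ-∷ h (just (colour c)) (ℕP.>⇒≢ e<k) (interior k (ℕP.<-trans a<e e<k) k<b)

  unrevealed-after-left : ∀ {k} → a ℕ.≤ k → k ℕ.< b → Apart l a (suc k) → revealedᵢ h k ≡ false
  unrevealed-after-left {k} a≤k k<b apart = unrevealed-beside l h a x k stˡ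
    (map₂ (λ a+1≢k+1 k≡a → a+1≢k+1 (cong suc (sym k≡a))) apart)
    (λ k≢a → interior k (ℕP.≤∧≢⇒< a≤k (k≢a ∘ sym)) k<b)

  unrevealed-before-right : ∀ {j} → a ℕ.< suc j → suc j ℕ.≤ b → Apart r j b → revealedᵢ h (suc j) ≡ false
  unrevealed-before-right {j} a<j+1 j+1≤b apart = unrevealed-beside r h b y (suc j) stʳ apart
    (λ j+1≢b → interior (suc j) a<j+1 (ℕP.≤∧≢⇒< j+1≤b j+1≢b))

  seed-isolated : ∀ {e} → a ℕ.< e → e ℕ.< b → Apart l a e → Apart r e b → isolatedᵢ h e ≡ true
  seed-isolated {suc e} a<e@(s≤s a≤e) e<b apartˡ apartʳ = isolatedᵢ-true h e
    (unrevealed-after-left a≤e (ℕP.<-trans (ℕP.n<1+n e) e<b) apartˡ)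
    (interior (suc e) a<e e<b)
    (unrevealed-before-right (ℕP.m<n⇒m<1+n a<e) e<b apartʳ)

Admissible : End → ℕ → Set
Admissible free     _ = ⊤
Admissible coloured d = 2 ℕ.≤ d

Apart⇒Admissible : ∀ l {i j} → i ℕ.< j → Apart l i j → Admissible l (j ∸ i)
Apart⇒Admissible free     _   _                = tt
Apart⇒Admissible coloured {i} {j} i<j (inj₂ i+1≢j) =
  ℕP.≤-trans (ℕP.≤-reflexive (sym (ℕP.m+n∸n≡m 2 i))) (ℕP.∸-monoˡ-≤ i (ℕP.≤∧≢⇒< i<j i+1≢j))

-- The expected loss in a gap

-- loss w x y D bounds the expected number of edges rejected in a gap of length D.  Every unit of
-- length costs ρ; in addition a coloured end pays the expected mismatch with the outermost seed
-- beyond ρ times their distance, which w records.  Between two consecutive seeds this excess is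
-- non-positive on average (seed-gap), so it can be dropped whenever a seed is joined to the rest.
module LossBound (p ρ : ℚ) (0≤p : 0ℚ ≤ p) (p≤1 : p ≤ 1ℚ) (0≤ρ : 0ℚ ≤ ρ)
  (seed-gap : ∀ d → 2 ℕ.≤ d → 𝔼 p (λ c → mismatchRate p c d) ≤ ρ * fromℕ d) where

  data Seeds (l r : End) : Set where
    none  : Seeds l r
    seeds : (first last : ℕ) → Admissible l first → Admissible r last → Seeds l r

  excess : End → Bool → ℕ → ℚ
  excess free     x d = 0ℚ
  excess coloured x d = mismatchRate p x d - ρ * fromℕ d

  unseededLoss : End → Bool → End → Bool → ℕ → ℚ
  unseededLoss coloured x coloured y D = fromBool (mismatch x y D)
  unseededLoss coloured x free     y D = 0ℚ
  unseededLoss free     x r        y D = 0ℚ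

  loss : ∀ {l r} → Seeds l r → Bool → Bool → ℕ → ℚ
  loss {l} {r} none              x y D = unseededLoss l x r y D
  loss {l} {r} (seeds d₁ dₖ _ _) x y D = ρ * fromℕ D + excess l x d₁ + excess r y dₖ

  Bound : End → ℕ → End → ℕ → List ℕ → Set
  Bound l a r b σ = Σ (Seeds l r) λ w →
    ∀ h x y → GapState l a x r b y h → fromℕ (length σ) - loss w x y (b ∸ a) ≤ expᵢ p h σ

  open ≤-Reasoning

  ρ*-nonNeg : ∀ D → 0ℚ ≤ ρ * fromℕ D
  ρ*-nonNeg D = *-nonNeg 0≤ρ (fromℕ-nonNeg D)

  unseededLoss-nonNeg : ∀ l x r y D → 0ℚ ≤ unseededLoss l x r y D
  unseededLoss-nonNeg coloured x coloured y D = fromBool-nonNeg (mismatch x y D)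
  unseededLoss-nonNeg coloured x free     y D = ≤-refl
  unseededLoss-nonNeg free     x r        y D = ≤-refl

  loss-free : ∀ (w : Seeds free free) x y D → loss w x y D ≤ ρ * fromℕ D
  loss-free none              x y D = ρ*-nonNeg D
  loss-free (seeds d₁ dₖ _ _) x y D = ≤-reflexive (trans (+-identityʳ _) (+-identityʳ _))

  𝔼-excess : ∀ d → 2 ℕ.≤ d → 𝔼 p (λ c → excess coloured c d) ≤ 0ℚ
  𝔼-excess d 2≤d = begin
    𝔼 p (λ c → mismatchRate p c d - ρ * fromℕ d)              ≡⟨ lemma p (mismatchRate p true d) (mismatchRate p false d) (ρ * fromℕ d) ⟩
    𝔼 p (λ c → mismatchRate p c d) - ρ * fromℕ d              ≤⟨ +-monoˡ-≤ (- (ρ * fromℕ d)) (seed-gap d 2≤d) ⟩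
    ρ * fromℕ d - ρ * fromℕ d                                 ≡⟨ +-inverseʳ (ρ * fromℕ d) ⟩
    0ℚ                                                        ∎
    where
    lemma : ∀ p a b r → p * (a - r) + (1ℚ - p) * (b - r) ≡ (p * a + (1ℚ - p) * b) - r
    lemma = solve-∀ ℚ-ring

  +-nonPos-≤ : ∀ K {z} → z ≤ 0ℚ → K + z ≤ K
  +-nonPos-≤ K {z} z≤0 = ≤-trans (+-monoʳ-≤ K z≤0) (≤-reflexive (+-identityʳ K))

  firstSeed : ∀ {l} → Σ ℕ (Admissible l) → Seeds l coloured → Σ ℕ (Admissible l)
  firstSeed d none              = d
  firstSeed _ (seeds d₁ _ a₁ _) = d₁ , a₁

  lastSeed : ∀ {r} → Σ ℕ (Admissible r) → Seeds coloured r → Σ ℕ (Admissible r)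
  lastSeed d none              = d
  lastSeed _ (seeds _ dₖ _ aₖ) = dₖ , aₖ

  join : ∀ {l r} → Σ ℕ (Admissible l) → Σ ℕ (Admissible r) → Seeds l coloured → Seeds coloured r → Seeds l r
  join dL dR wL wR = seeds (proj₁ (firstSeed dL wL)) (proj₁ (lastSeed dR wR)) (proj₂ (firstSeed dL wL)) (proj₂ (lastSeed dR wR))

  m≡r+[m-r] : ∀ m r → m ≡ r + (m - r)
  m≡r+[m-r] = solve-∀ ℚ-ring

  𝔼-0≤ρD : ∀ D → 𝔼 p (λ _ → 0ℚ) ≤ ρ * fromℕ D + 0ℚ
  𝔼-0≤ρD D = begin
    𝔼 p (λ _ → 0ℚ)      ≡⟨ 𝔼-const p 0ℚ ⟩
    0ℚ                  ≤⟨ ρ*-nonNeg D ⟩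
    ρ * fromℕ D         ≡⟨ sym (+-identityʳ _) ⟩
    ρ * fromℕ D + 0ℚ    ∎

  𝔼-loss-left : ∀ {l} x (dL : Σ ℕ (Admissible l)) (wL : Seeds l coloured) →
    𝔼 p (λ c → loss wL x c (proj₁ dL)) ≤ ρ * fromℕ (proj₁ dL) + excess l x (proj₁ (firstSeed dL wL))
  𝔼-loss-left {coloured} x (D , _) none = ≤-reflexive (m≡r+[m-r] (mismatchRate p x D) (ρ * fromℕ D))
  𝔼-loss-left {free}     x (D , _) none = 𝔼-0≤ρD D
  𝔼-loss-left {l} x (D , _) (seeds d₁ dₖ _ 2≤dₖ) = begin
    𝔼 p (λ c → (ρ * fromℕ D + excess l x d₁) + excess coloured c dₖ)  ≡⟨ 𝔼-shift p (ρ * fromℕ D + excess l x d₁) (λ c → excess coloured c dₖ) ⟩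
    (ρ * fromℕ D + excess l x d₁) + 𝔼 p (λ c → excess coloured c dₖ)  ≤⟨ +-nonPos-≤ (ρ * fromℕ D + excess l x d₁) (𝔼-excess dₖ 2≤dₖ) ⟩
    ρ * fromℕ D + excess l x d₁                                        ∎

  𝔼-loss-right : ∀ {r} y (dR : Σ ℕ (Admissible r)) (wR : Seeds coloured r) →
    𝔼 p (λ c → loss wR c y (proj₁ dR)) ≤ ρ * fromℕ (proj₁ dR) + excess r y (proj₁ (lastSeed dR wR))
  𝔼-loss-right {coloured} y (D , _) none = ≤-reflexive (begin-equality
    𝔼 p (λ c → fromBool (mismatch c y D))  ≡⟨ 𝔼-cong p (λ c → cong fromBool (mismatch-comm c y D)) ⟩
    mismatchRate p y D                      ≡⟨ m≡r+[m-r] (mismatchRate p y D) (ρ * fromℕ D) ⟩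
    ρ * fromℕ D + excess coloured y D       ∎)
  𝔼-loss-right {free}     y (D , _) none = 𝔼-0≤ρD D
  𝔼-loss-right {r} y (D , _) (seeds d₁ dₖ 2≤d₁ _) = begin
    𝔼 p (λ c → ρ * fromℕ D + excess coloured c d₁ + excess r y dₖ)    ≡⟨ 𝔼-cong p (λ c → lemma (ρ * fromℕ D) (excess coloured c d₁) (excess r y dₖ)) ⟩
    𝔼 p (λ c → (ρ * fromℕ D + excess r y dₖ) + excess coloured c d₁)  ≡⟨ 𝔼-shift p (ρ * fromℕ D + excess r y dₖ) (λ c → excess coloured c d₁) ⟩
    (ρ * fromℕ D + excess r y dₖ) + 𝔼 p (λ c → excess coloured c d₁)  ≤⟨ +-nonPos-≤ (ρ * fromℕ D + excess r y dₖ) (𝔼-excess d₁ 2≤d₁) ⟩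
    ρ * fromℕ D + excess r y dₖ                                        ∎
    where
    lemma : ∀ a b c → a + b + c ≡ (a + c) + b
    lemma = solve-∀ ℚ-ring

  𝔼-loss-join : ∀ {l r} x y (dL : Σ ℕ (Admissible l)) (dR : Σ ℕ (Admissible r)) wL wR →
    𝔼 p (λ c → loss wL x c (proj₁ dL) + loss wR c y (proj₁ dR)) ≤ loss (join dL dR wL wR) x y (proj₁ dL ℕ.+ proj₁ dR)
  𝔼-loss-join {l} {r} x y dL@(DL , _) dR@(DR , _) wL wR = begin
    𝔼 p (λ c → loss wL x c DL + loss wR c y DR)
      ≡⟨ 𝔼-+ p (λ c → loss wL x c DL) (λ c → loss wR c y DR) ⟩
    𝔼 p (λ c → loss wL x c DL) + 𝔼 p (λ c → loss wR c y DR)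
      ≤⟨ +-mono-≤ (𝔼-loss-left x dL wL) (𝔼-loss-right y dR wR) ⟩
    (ρ * fromℕ DL + excess l x d₁) + (ρ * fromℕ DR + excess r y dₖ)
      ≡⟨ lemma ρ (fromℕ DL) (fromℕ DR) (excess l x d₁) (excess r y dₖ) ⟩
    ρ * (fromℕ DL + fromℕ DR) + excess l x d₁ + excess r y dₖ
      ≡⟨ cong (λ z → ρ * z + excess l x d₁ + excess r y dₖ) (sym (fromℕ-+ DL DR)) ⟩
    ρ * fromℕ (DL ℕ.+ DR) + excess l x d₁ + excess r y dₖ ∎
    where
    d₁ = proj₁ (firstSeed dL wL)
    dₖ = proj₁ (lastSeed dR wR)
    lemma : ∀ ρ a b u v → (ρ * a + u) + (ρ * b + v) ≡ ρ * (a + b) + u + v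
    lemma = solve-∀ ℚ-ring

  shiftFirst : ∀ {r} → Seeds coloured r → Seeds coloured r
  shiftFirst none                = none
  shiftFirst (seeds d₁ dₖ a₁ aₖ) = seeds (suc d₁) dₖ (ℕP.m≤n⇒m≤1+n a₁) aₖ

  shiftLast : ∀ {l} → Seeds l coloured → Seeds l coloured
  shiftLast none                = none
  shiftLast (seeds d₁ dₖ a₁ aₖ) = seeds d₁ (suc dₖ) a₁ (ℕP.m≤n⇒m≤1+n aₖ)

  loss-shiftFirst : ∀ {r} (w : Seeds coloured r) x y D → loss w (not x) y D ≡ loss (shiftFirst w) x y (suc D)
  loss-shiftFirst {coloured} none x y D = refl
  loss-shiftFirst {free}     none x y D = refl
  loss-shiftFirst {r} (seeds d₁ dₖ _ _) x y D rewrite fromℕ-suc D | fromℕ-suc d₁ =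
    lemma ρ (fromℕ D) (fromℕ d₁) (mismatchRate p (not x) d₁) (excess r y dₖ)
    where
    lemma : ∀ ρ D d m e → ρ * D + (m - ρ * d) + e ≡ ρ * (1ℚ + D) + (m - ρ * (1ℚ + d)) + e
    lemma = solve-∀ ℚ-ring

  loss-shiftLast : ∀ {l} (w : Seeds l coloured) x y D → loss w x (not y) D ≡ loss (shiftLast w) x y (suc D)
  loss-shiftLast {coloured} none x y D = cong fromBool (mismatch-sucʳ x y D)
  loss-shiftLast {free}     none x y D = refl
  loss-shiftLast {l} (seeds d₁ dₖ _ _) x y D rewrite fromℕ-suc D | fromℕ-suc dₖ =
    lemma ρ (fromℕ D) (fromℕ dₖ) (mismatchRate p (not y) dₖ) (excess l x d₁)
    where
    lemma : ∀ ρ D d m e → ρ * D + e + (m - ρ * d) ≡ ρ * (1ℚ + D) + e + (m - ρ * (1ℚ + d))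
    lemma = solve-∀ ℚ-ring

  fromℕ-suc-minus : ∀ n V X → fromℕ n - V ≤ X → fromℕ (suc n) - V ≤ 1ℚ + X
  fromℕ-suc-minus n V X n-V≤X = begin
    fromℕ (suc n) - V    ≡⟨ cong (_- V) (fromℕ-suc n) ⟩
    (1ℚ + fromℕ n) - V   ≡⟨ +-assoc 1ℚ (fromℕ n) (- V) ⟩
    1ℚ + (fromℕ n - V)   ≤⟨ +-monoʳ-≤ 1ℚ n-V≤X ⟩
    1ℚ + X               ∎

  seed-step : ∀ nL nR (XL XR VL VR : Bool → ℚ) V →
    (∀ c → fromℕ nL - VL c ≤ XL c) → (∀ c → fromℕ nR - VR c ≤ XR c) → 𝔼 p (λ c → VL c + VR c) ≤ V →
    fromℕ (suc (nL ℕ.+ nR)) - V ≤ 𝔼 p (λ c → 1ℚ + (XL c + XR c))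
  seed-step nL nR XL XR VL VR V boundL boundR 𝔼V≤V = begin
    fromℕ (suc (nL ℕ.+ nR)) - V
      ≤⟨ +-monoʳ-≤ (fromℕ (suc (nL ℕ.+ nR))) (neg-antimono-≤ 𝔼V≤V) ⟩
    fromℕ (suc (nL ℕ.+ nR)) - 𝔼 p (λ c → VL c + VR c)
      ≡⟨ cong (_- 𝔼 p (λ c → VL c + VR c)) (trans (fromℕ-suc (nL ℕ.+ nR)) (cong (λ x → 1ℚ + x) (fromℕ-+ nL nR))) ⟩
    (1ℚ + (fromℕ nL + fromℕ nR)) - 𝔼 p (λ c → VL c + VR c)
      ≡⟨ lemma p (fromℕ nL) (fromℕ nR) (VL true) (VR true) (VL false) (VR false) ⟩
    𝔼 p (λ c → 1ℚ + ((fromℕ nL - VL c) + (fromℕ nR - VR c)))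
      ≤⟨ 𝔼-mono-≤ 0≤p p≤1 (λ c → +-monoʳ-≤ 1ℚ (+-mono-≤ (boundL c) (boundR c))) ⟩
    𝔼 p (λ c → 1ℚ + (XL c + XR c)) ∎
    where
    lemma : ∀ p A B u v u′ v′ → (1ℚ + (A + B)) - (p * (u + v) + (1ℚ - p) * (u′ + v′))
                              ≡ p * (1ℚ + ((A - u) + (B - v))) + (1ℚ - p) * (1ℚ + ((A - u′) + (B - v′)))
    lemma = solve-∀ ℚ-ring

  Bounded : ℕ → Set
  Bounded n = ∀ l a r b σ → length σ ℕ.≤ n → Unique σ → Inside a b σ → Bound l a r b σ

  bound-[] : ∀ l a r b → Bound l a r b []
  bound-[] l a r b = none , λ h x y _ →
    +-monoʳ-≤ 0ℚ (neg-antimono-≤ (unseededLoss-nonNeg l x r y (b ∸ a)))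

  bound-seed : ∀ {n} → Bounded n → ∀ {l a r b e σ} → length σ ℕ.≤ n → Unique σ → All (e ≢_) σ → Inside a b σ →
    a ℕ.< e → e ℕ.< b → Apart l a e → Apart r e b → Bound l a r b (e ∷ σ)
  bound-seed ih {l} {a} {r} {b} {e} {σ} len uσ e∉σ inside a<e e<b apartˡ apartʳ = W , main
    where
    σ≢e : All (_≢ e) σ
    σ≢e = All.map (_∘ sym) e∉σ
    σL σR : List ℕ
    σL = below e σ
    σR = above e σ
    boundL : Bound l a coloured e σL
    boundL = ih l a coloured e σL (ℕP.≤-trans (length-filter (ℕ._<? e) σ) len) (Unique.filter⁺ (ℕ._<? e) uσ)
      (Inside-below e inside)
    boundR : Bound coloured e r b σR
    boundR = ih coloured e r b σR (ℕP.≤-trans (length-filter (λ j → ¬? (j ℕ.<? e)) σ) len)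
      (Unique.filter⁺ (λ j → ¬? (j ℕ.<? e)) uσ) (Inside-above e σ≢e inside)
    wL = proj₁ boundL
    wR = proj₁ boundR
    dL = e ∸ a , Apart⇒Admissible l a<e apartˡ
    dR = b ∸ e , Apart⇒Admissible r e<b apartʳ
    W = join dL dR wL wR
    main : ∀ h x y → GapState l a x r b y h → fromℕ (suc (length σ)) - loss W x y (b ∸ a) ≤ expᵢ p h (e ∷ σ)
    main h x y st = begin
      fromℕ (suc (length σ)) - loss W x y (b ∸ a)
        ≡⟨ cong₂ (λ n D → fromℕ (suc n) - loss W x y D) (length-below-above e σ) (∸-split (ℕP.<⇒≤ a<e) (ℕP.<⇒≤ e<b)) ⟩
      fromℕ (suc (length σL ℕ.+ length σR)) - loss W x y ((e ∸ a) ℕ.+ (b ∸ e))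
        ≤⟨ seed-step (length σL) (length σR) (λ c → expᵢ p (h⁺ c) σL) (λ c → expᵢ p (h⁺ c) σR)
             (λ c → loss wL x c (e ∸ a)) (λ c → loss wR c y (b ∸ e)) (loss W x y ((e ∸ a) ℕ.+ (b ∸ e)))
             (λ c → proj₂ boundL (h⁺ c) x c (GapState-seedˡ st a<e e<b c))
             (λ c → proj₂ boundR (h⁺ c) c y (GapState-seedʳ st a<e e<b c))
             (𝔼-loss-join x y dL dR wL wR) ⟩
      𝔼 p (λ c → 1ℚ + (expᵢ p (h⁺ c) σL + expᵢ p (h⁺ c) σR))
        ≡⟨ 𝔼-cong p (λ c → cong (λ x → 1ℚ + x) (sym (expᵢ-split p e (h⁺ c) σ σ≢e))) ⟩
      𝔼 p (λ c → 1ℚ + expᵢ p (h⁺ c) σ)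
        ≡⟨ sym (expᵢ-isolated p h e σ (seed-isolated st a<e e<b apartˡ apartʳ)) ⟩
      expᵢ p h (e ∷ σ) ∎
      where
      h⁺ : Bool → Historyᵢ
      h⁺ c = (e , just (colour c)) ∷ h

  bound-extendˡ : ∀ {n} → Bounded n → ∀ {a r b σ} → length σ ℕ.≤ n → Unique σ → All (suc a ≢_) σ → Inside a b σ →
    suc a ℕ.< b → Apart r (suc a) b → Bound coloured a r b (suc a ∷ σ)
  bound-extendˡ ih {a} {r} {b} {σ} len uσ e∉σ inside a+1<b apartʳ = shiftFirst w , main
    where
    IH = ih coloured (suc a) r b σ len uσ
      (All.zipWith (λ ((a<j , j<b) , a+1≢j) → ℕP.≤∧≢⇒< a<j a+1≢j , j<b) (inside , e∉σ))
    w = proj₁ IH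
    main : ∀ h x y → GapState coloured a x r b y h →
      fromℕ (suc (length σ)) - loss (shiftFirst w) x y (b ∸ a) ≤ expᵢ p h (suc a ∷ σ)
    main h x y st@(stˡ , stʳ , interior) = begin
      fromℕ (suc (length σ)) - loss (shiftFirst w) x y (b ∸ a)
        ≡⟨ cong (λ D → fromℕ (suc (length σ)) - loss (shiftFirst w) x y D) (ℕP.+-∸-assoc 1 (ℕP.<⇒≤ a+1<b)) ⟩
      fromℕ (suc (length σ)) - loss (shiftFirst w) x y (suc (b ∸ suc a))
        ≡⟨ cong (λ V → fromℕ (suc (length σ)) - V) (sym (loss-shiftFirst w x y (b ∸ suc a))) ⟩
      fromℕ (suc (length σ)) - loss w (not x) y (b ∸ suc a)
        ≤⟨ fromℕ-suc-minus (length σ) _ _ (proj₂ IH h⁺ (not x) y (GapState-seedʳ st (ℕP.n<1+n a) a+1<b (not x))) ⟩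
      1ℚ + expᵢ p h⁺ σ
        ≡⟨ sym (expᵢ-extend p h (suc a) σ (isolatedᵢ-falseˡ h a (EndState⇒revealed h a x stˡ)) extends) ⟩
      expᵢ p h (suc a ∷ σ) ∎
      where
      h⁺ = (suc a , just (colour (not x))) ∷ h
      extends : greedyᵢ h (suc a) ≡ just (colour (not x))
      extends = greedyᵢ-extendˡ h a x stˡ (interior (suc a) (ℕP.n<1+n a) a+1<b)
        (unrevealed-before-right st (ℕP.m<n⇒m<1+n (ℕP.n<1+n a)) a+1<b apartʳ)

  bound-extendʳ : ∀ {n} → Bounded n → ∀ {l a e σ} → length σ ℕ.≤ n → Unique σ → All (e ≢_) σ → Inside a (suc e) σ →
    a ℕ.< e → Apart l a e → Bound l a coloured (suc e) (e ∷ σ)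
  bound-extendʳ ih {l} {a} {suc e′} {σ} len uσ e∉σ inside a<e@(s≤s a≤e′) apartˡ = shiftLast w , main
    where
    e = suc e′
    IH = ih l a coloured e σ len uσ
      (All.zipWith (λ ((a<j , j<e+1) , e≢j) → a<j , ℕP.≤∧≢⇒< (ℕP.≤-pred j<e+1) (e≢j ∘ sym)) (inside , e∉σ))
    w = proj₁ IH
    main : ∀ h x y → GapState l a x coloured (suc e) y h →
      fromℕ (suc (length σ)) - loss (shiftLast w) x y (suc e ∸ a) ≤ expᵢ p h (e ∷ σ)
    main h x y st@(stˡ , stʳ , interior) = begin
      fromℕ (suc (length σ)) - loss (shiftLast w) x y (suc e ∸ a)
        ≡⟨ cong (λ D → fromℕ (suc (length σ)) - loss (shiftLast w) x y D) (ℕP.+-∸-assoc 1 (ℕP.<⇒≤ a<e)) ⟩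
      fromℕ (suc (length σ)) - loss (shiftLast w) x y (suc (e ∸ a))
        ≡⟨ cong (λ V → fromℕ (suc (length σ)) - V) (sym (loss-shiftLast w x y (e ∸ a))) ⟩
      fromℕ (suc (length σ)) - loss w x (not y) (e ∸ a)
        ≤⟨ fromℕ-suc-minus (length σ) _ _ (proj₂ IH h⁺ x (not y) (GapState-seedˡ st a<e (ℕP.n<1+n e) (not y))) ⟩
      1ℚ + expᵢ p h⁺ σ
        ≡⟨ sym (expᵢ-extend p h e σ (isolatedᵢ-falseʳ h e′ (EndState⇒revealed h (suc e) y stʳ)) extends) ⟩
      expᵢ p h (e ∷ σ) ∎
      where
      h⁺ = (e , just (colour (not y))) ∷ h
      extends : greedyᵢ h e ≡ just (colour (not y))
      extends = greedyᵢ-extendʳ h e′ y stʳ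
        (unrevealed-after-left st a≤e′ (ℕP.<-trans (ℕP.n<1+n e′) (ℕP.n<1+n e)) apartˡ)
        (interior e a<e (ℕP.n<1+n e))

  bound-bridge : ∀ {a σ} → All (suc a ≢_) σ → Inside a (suc (suc a)) σ → Bound coloured a coloured (suc (suc a)) (suc a ∷ σ)
  bound-bridge {a} {j ∷ _} (a+1≢j ∷ _) ((a<j , j<a+2) ∷ _) = ⊥-elim (a+1≢j (ℕP.≤-antisym a<j (ℕP.≤-pred j<a+2)))
  bound-bridge {a} {[]} _ _ = none , λ h x y (stˡ , stʳ , interior) → ≤-reflexive (begin-equality
    fromℕ 1 - fromBool (mismatch x y (suc (suc a) ∸ a))
      ≡⟨ cong (λ d → 1ℚ - fromBool (mismatch x y d)) (ℕP.m+n∸n≡m 2 a) ⟩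
    1ℚ - fromBool (mismatch x y 2)
      ≡⟨ sym (+-identityʳ _) ⟩
    (1ℚ - fromBool (mismatch x y 2)) + 0ℚ
      ≡⟨ sym (expᵢ-bridge p h a x y [] stˡ stʳ (interior (suc a) (ℕP.n<1+n a) (ℕP.n<1+n (suc a)))) ⟩
    expᵢ p h (suc a ∷ []) ∎)

  bound : ∀ n → Bounded n
  bound n       l a r b []      _         _          _ = bound-[] l a r b
  bound (suc n) l a r b (e ∷ σ) (s≤s len) (e∉σ ∷ uσ) ((a<e , e<b) ∷ inside)
    with apart? l a e | apart? r e b
  ... | inj₁ apartˡ        | inj₁ apartʳ        = bound-seed (bound n) len uσ e∉σ inside a<e e<b apartˡ apartʳ
  ... | inj₂ (refl , refl) | inj₁ apartʳ        = bound-extendˡ (bound n) len uσ e∉σ inside e<b apartʳ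
  ... | inj₁ apartˡ        | inj₂ (refl , refl) = bound-extendʳ (bound n) len uσ e∉σ inside a<e apartˡ
  ... | inj₂ (refl , refl) | inj₂ (refl , refl) = bound-bridge e∉σ inside

-- Path inputs as positions

nth : List ℕ → ℕ → ℕ
nth []       _       = 0
nth (v ∷ vs) zero    = v
nth (v ∷ vs) (suc k) = nth vs k

All-nth : ∀ {P : ℕ → Set} vs {β} → All P vs → β ℕ.< length vs → P (nth vs β)
All-nth (v ∷ vs) {zero}  (pv ∷ _)  _        = pv
All-nth (v ∷ vs) {suc β} (_ ∷ pvs) (s≤s β<) = All-nth vs pvs β<

nth-injective : ∀ vs {α β} → Unique vs → α ℕ.< length vs → β ℕ.< length vs → nth vs α ≡ nth vs β → α ≡ β
nth-injective (v ∷ vs) {zero}  {zero}  _         _        _        _  = refl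
nth-injective (v ∷ vs) {zero}  {suc β} (v∉ ∷ _)  _        (s≤s β<) eq = ⊥-elim (All-nth vs v∉ β< eq)
nth-injective (v ∷ vs) {suc α} {zero}  (v∉ ∷ _)  (s≤s α<) _        eq = ⊥-elim (All-nth vs v∉ α< (sym eq))
nth-injective (v ∷ vs) {suc α} {suc β} (_ ∷ uvs) (s≤s α<) (s≤s β<) eq = cong suc (nth-injective vs uvs α< β< eq)

nth-≡ᵇ : ∀ vs {α β} → Unique vs → α ℕ.< length vs → β ℕ.< length vs → (nth vs α ≡ᵇ nth vs β) ≡ (α ≡ᵇ β)
nth-≡ᵇ vs uvs α< β< = ≡ᵇ-cong-⇔ (mk⇔ (nth-injective vs uvs α< β<) (cong (nth vs)))

OnPath : List ℕ → Edge → ℕ → Set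
OnPath vs e i = Σ ℕ λ k → i ≡ suc k × SameEdge e (nth vs k , nth vs (suc k)) × suc k ℕ.< length vs

OnPath-∷ : ∀ {vs e i} v → OnPath vs e i → OnPath (v ∷ vs) e (suc i)
OnPath-∷ v (k , refl , same , k+1<) = suc k , refl , same , s≤s k+1<

incident-flip : ∀ x u v → incident x (v , u) ≡ incident x (u , v)
incident-flip x u v = ∨-comm (x ≡ᵇ v) (x ≡ᵇ u)

touches-flipˡ : ∀ u v e → touches (v , u) e ≡ touches (u , v) e
touches-flipˡ u v e = ∨-comm (incident v e) (incident u e)

touches-flipʳ : ∀ e u v → touches e (v , u) ≡ touches e (u , v)
touches-flipʳ (a , b) u v = cong₂ _∨_ (incident-flip a u v) (incident-flip b u v)

touches-SameEdge : ∀ {e e′} f f′ → SameEdge e f → SameEdge e′ f′ → touches e e′ ≡ touches f f′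
touches-SameEdge _       _         (inj₁ (refl , refl)) (inj₁ (refl , refl)) = refl
touches-SameEdge (c , d) (c′ , d′) (inj₁ (refl , refl)) (inj₂ (refl , refl)) = touches-flipʳ (c , d) c′ d′
touches-SameEdge (c , d) (c′ , d′) (inj₂ (refl , refl)) (inj₁ (refl , refl)) = touches-flipˡ c d (c′ , d′)
touches-SameEdge (c , d) (c′ , d′) (inj₂ (refl , refl)) (inj₂ (refl , refl)) =
  trans (touches-flipˡ c d (d′ , c′)) (touches-flipʳ (c , d) c′ d′)

touches-OnPath : ∀ vs → Unique vs → ∀ {e e′ i j} → OnPath vs e i → OnPath vs e′ j → touches e e′ ≡ adjacentᵢ i j
touches-OnPath vs uvs (k , refl , same , k+1<) (k′ , refl , same′ , k′+1<) =
  trans (touches-SameEdge _ _ same same′)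
    (cong₂ _∨_ (cong₂ _∨_ (nth-≡ᵇ vs uvs k< k′<) (nth-≡ᵇ vs uvs k< k′+1<))
               (cong₂ _∨_ (nth-≡ᵇ vs uvs k+1< k′<) (nth-≡ᵇ vs uvs k+1< k′+1<)))
  where
  k<  = ℕP.<-trans (ℕP.n<1+n k) k+1<
  k′< = ℕP.<-trans (ℕP.n<1+n k′) k′+1<

OnPathᴴ : List ℕ → Edge × Maybe ℕ → ℕ × Maybe ℕ → Set
OnPathᴴ vs (e , m) (i , m′) = OnPath vs e i × m ≡ m′

module _ {vs} (uvs : Unique vs) {h hᵢ} (h≈hᵢ : Pointwise (OnPathᴴ vs) h hᵢ) where

  isolated-OnPath : ∀ {e i} → OnPath vs e i → isolated h e ≡ isolatedᵢ hᵢ i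
  isolated-OnPath {u , v} e~i = cong not (any-Pointwise _ _ (λ (e′~j , _) → touches-OnPath vs uvs e~i e′~j) h≈hᵢ)

  blocked-OnPath : ∀ {e i} c → OnPath vs e i → blocked h e c ≡ blockedᵢ hᵢ i c
  blocked-OnPath {u , v} c e~i = trans (sym (any-∨ (λ y → incident u (proj₁ y) ∧ isColor (proj₂ y) c)
                                                    (λ y → incident v (proj₁ y) ∧ isColor (proj₂ y) c) h))
    (trans (any-cong h (λ y → sym (∧-distribʳ-∨ (isColor (proj₂ y) c) (incident u (proj₁ y)) (incident v (proj₁ y)))))
      (any-Pointwise _ _ (λ { (e′~j , refl) → cong (_∧ _) (touches-OnPath vs uvs e~i e′~j) }) h≈hᵢ))

  greedy-OnPath : ∀ {e i} → OnPath vs e i → greedy h e ≡ greedyᵢ hᵢ i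
  greedy-OnPath e~i = cong₂ (λ b₁ b₂ → if not b₁ then just 1 else if not b₂ then just 2 else nothing)
    (blocked-OnPath 1 e~i) (blocked-OnPath 2 e~i)

expRPFrom-OnPath : ∀ p {vs} → Unique vs → ∀ {h hᵢ σ σᵢ} → Pointwise (OnPathᴴ vs) h hᵢ → Pointwise (OnPath vs) σ σᵢ →
  expRPFrom p h σ ≡ expᵢ p hᵢ σᵢ
expRPFrom-OnPath p uvs h≈hᵢ []                = refl
expRPFrom-OnPath p uvs {h} {hᵢ} {e ∷ σ} {i ∷ σᵢ} h≈hᵢ (e~i ∷ σ~σᵢ)
  rewrite isolated-OnPath uvs h≈hᵢ e~i | greedy-OnPath uvs h≈hᵢ e~i
        | expRPFrom-OnPath p uvs {(e , just 1) ∷ h} {(i , just 1) ∷ hᵢ} ((e~i , refl) ∷ h≈hᵢ) σ~σᵢ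
        | expRPFrom-OnPath p uvs {(e , just 2) ∷ h} {(i , just 2) ∷ hᵢ} ((e~i , refl) ∷ h≈hᵢ) σ~σᵢ
        | expRPFrom-OnPath p uvs {(e , greedyᵢ hᵢ i) ∷ h} {(i , greedyᵢ hᵢ i) ∷ hᵢ} ((e~i , refl) ∷ h≈hᵢ) σ~σᵢ
  = refl

range : ℕ → ℕ → List ℕ
range s zero    = []
range s (suc n) = s ∷ range (suc s) n

range-length : ∀ s n → length (range s n) ≡ n
range-length s zero    = refl
range-length s (suc n) = cong suc (range-length (suc s) n)

range-≥ : ∀ s n → All (s ℕ.≤_) (range s n)
range-≥ s zero    = []
range-≥ s (suc n) = ℕP.≤-refl ∷ All.map ℕP.<⇒≤ (range-≥ (suc s) n)

range-Unique : ∀ s n → Unique (range s n)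
range-Unique s zero    = []
range-Unique s (suc n) = All.map (λ s<j → ℕP.<⇒≢ s<j) (range-≥ (suc s) n) ∷ range-Unique (suc s) n

Pointwise-range-suc : ∀ {A : Set} {R S : A → ℕ → Set} → (∀ {x i} → R x i → S x (suc i)) →
  ∀ {xs} s n → Pointwise R xs (range s n) → Pointwise S xs (range (suc s) n)
Pointwise-range-suc R⇒S s zero    []       = []
Pointwise-range-suc R⇒S s (suc n) (r ∷ rs) = R⇒S r ∷ Pointwise-range-suc R⇒S (suc s) n rs

pathEdges-OnPath : ∀ vs {τ} → Pointwise SameEdge τ (pathEdges vs) → Pointwise (OnPath vs) τ (range 1 (length vs ∸ 1))
pathEdges-OnPath []           []         = []
pathEdges-OnPath (v ∷ [])     []         = []
pathEdges-OnPath (v ∷ w ∷ vs) (same ∷ τ≈) =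
  (0 , refl , same , s≤s (s≤s z≤n)) ∷ Pointwise-range-suc (OnPath-∷ v) 1 (length vs) (pathEdges-OnPath (w ∷ vs) τ≈)

Pointwise-↭ : ∀ {A B : Set} {R : A → B → Set} {xs ys zs} → xs ↭ ys → Pointwise R ys zs →
  ∃[ ws ] Pointwise R xs ws × ws ↭ zs
Pointwise-↭ {zs = zs} ↭.refl xs≈zs = zs , xs≈zs , ↭.refl
Pointwise-↭ (↭.prep x xs↭ys) (r ∷ ys≈zs) with Pointwise-↭ xs↭ys ys≈zs
... | ws , xs≈ws , ws↭zs = _ ∷ ws , r ∷ xs≈ws , ↭.prep _ ws↭zs
Pointwise-↭ (↭.swap x y xs↭ys) (r ∷ r′ ∷ ys≈zs) with Pointwise-↭ xs↭ys ys≈zs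
... | ws , xs≈ws , ws↭zs = _ ∷ _ ∷ ws , r′ ∷ r ∷ xs≈ws , ↭.swap _ _ ws↭zs
Pointwise-↭ (↭.trans xs↭ys ys↭zs) ys≈zs with Pointwise-↭ ys↭zs ys≈zs
... | ws , ys≈ws , ws↭zs with Pointwise-↭ xs↭ys ys≈ws
...   | ws′ , xs≈ws′ , ws′↭ws = ws′ , xs≈ws′ , ↭.trans ws′↭ws ws↭zs

Unique-resp-↭ : ∀ {xs ys : List ℕ} → xs ↭ ys → Unique xs → Unique ys
Unique-resp-↭ xs↭ys = Permₛ.AllPairs-resp-↭ (setoid ℕ) ≢-sym ((λ { refl ne → ne }) , (λ { refl ne → ne })) (↭⇒↭ₛ xs↭ys)

OnPath-inside : ∀ vs {σ σᵢ} → Pointwise (OnPath vs) σ σᵢ → Inside 0 (length vs) σᵢ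
OnPath-inside vs []                             = []
OnPath-inside vs ((k , refl , _ , k+1<) ∷ rs) = (s≤s z≤n , k+1<) ∷ OnPath-inside vs rs

path-positions : ∀ σ → IsPathInput σ →
  ∃[ σᵢ ] Unique σᵢ × Inside 0 (suc (length σ)) σᵢ × length σ ≡ length σᵢ × (∀ p → expRP p σ ≡ expᵢ p [] σᵢ)
path-positions σ (vs , τ , uvs , σ↭τ , τ≈path) with Pointwise-↭ {R = OnPath vs} σ↭τ (pathEdges-OnPath vs τ≈path)
... | σᵢ , σ≈σᵢ , σᵢ↭ = σᵢ , Unique-resp-↭ (↭-sym σᵢ↭) (range-Unique 1 (length vs ∸ 1))
    , All.map (λ (0<i , i<) → 0<i , ℕP.<-≤-trans i< vs≤) (OnPath-inside vs σ≈σᵢ)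
    , Pointwise-length σ≈σᵢ
    , λ p → expRPFrom-OnPath p uvs [] σ≈σᵢ
  where
  vs≤ : length vs ℕ.≤ suc (length σ)
  vs≤ = ℕP.≤-trans (ℕP.m≤n+m∸n (length vs) 1)
    (ℕP.≤-reflexive (cong suc (trans (sym (range-length 1 (length vs ∸ 1)))
      (trans (sym (Perm.↭-length σᵢ↭)) (sym (Pointwise-length σ≈σᵢ))))))

-- Two families of hard inputs

chain : ℚ → (Bool → Bool → ℚ) → Bool → ℕ → ℚ
chain p g c zero    = 0ℚ
chain p g c (suc k) = 𝔼 p (λ z → g c z + chain p g z k)

𝔼-chain : ∀ p g k → 𝔼 p (λ c → chain p g c k) ≡ fromℕ k * 𝔼 p (λ c → 𝔼 p (g c))
𝔼-chain p g zero    = trans (𝔼-const p 0ℚ) (sym (*-zeroˡ (𝔼 p (λ c → 𝔼 p (g c)))))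
𝔼-chain p g (suc k) = begin
  𝔼 p (λ c → 𝔼 p (λ z → g c z + chain p g z k))
    ≡⟨ 𝔼-cong p (λ c → 𝔼-+ p (g c) (λ z → chain p g z k)) ⟩
  𝔼 p (λ c → 𝔼 p (g c) + 𝔼 p (λ z → chain p g z k))
    ≡⟨ 𝔼-+ p (λ c → 𝔼 p (g c)) (λ _ → 𝔼 p (λ z → chain p g z k)) ⟩
  G + 𝔼 p (λ _ → 𝔼 p (λ z → chain p g z k))
    ≡⟨ cong (λ x → G + x) (trans (𝔼-const p _) (𝔼-chain p g k)) ⟩
  G + fromℕ k * G
    ≡⟨ lemma G (fromℕ k) ⟩
  (1ℚ + fromℕ k) * G
    ≡⟨ cong (_* G) (sym (fromℕ-suc k)) ⟩
  fromℕ (suc k) * G ∎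
  where
  open ≡-Reasoning
  G = 𝔼 p (λ c → 𝔼 p (g c))
  lemma : ∀ G k → G + k * G ≡ (1ℚ + k) * G
  lemma = solve-∀ ℚ-ring

Fresh : Historyᵢ → ℕ → Bool → Set
Fresh h s c = EndState coloured h s c × (∀ j → s ℕ.< j → revealedᵢ h j ≡ false)

Fresh-seed : ∀ h {s c e} z → Fresh h s c → s ℕ.< e → Fresh ((e , just (colour z)) ∷ h) e z
Fresh-seed h {s} {c} {e} z (_ , unr) s<e =
  EndState-new h e z (unr e s<e) , λ j e<j → revealedᵢ-∷ h (just (colour z)) (ℕP.>⇒≢ e<j) (unr j (ℕP.<-trans s<e e<j))

Fresh-∷ : ∀ h {e z j} m → j ℕ.< e → Fresh h e z → Fresh ((j , m) ∷ h) e z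
Fresh-∷ h m j<e (st , unr) =
  EndState-∷ coloured h m (ℕP.>⇒≢ j<e) st , λ k e<k → revealedᵢ-∷ h m (ℕP.>⇒≢ (ℕP.<-trans j<e e<k)) (unr k e<k)

-- After the seed s + 2, the edge s + 1 is rejected iff the seeds s and s + 2 differ in colour.
pairs : ℕ → ℕ → List ℕ
pairs s zero    = []
pairs s (suc k) = suc (suc s) ∷ suc s ∷ pairs (suc (suc s)) k

-- After the seed s + 3, the edge s + 1 extends s greedily, and s + 2 is rejected iff the seeds
-- s and s + 3 have the same colour.
triples : ℕ → ℕ → List ℕ
triples s zero    = []
triples s (suc k) = suc (suc (suc s)) ∷ suc s ∷ suc (suc s) ∷ triples (suc (suc (suc s))) k

n<2+n : ∀ n → n ℕ.< suc (suc n)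
n<2+n n = ℕP.<-trans (ℕP.n<1+n n) (ℕP.n<1+n (suc n))

n<3+n : ∀ n → n ℕ.< suc (suc (suc n))
n<3+n n = ℕP.<-trans (n<2+n n) (ℕP.n<1+n (suc (suc n)))

pairGain : Bool → Bool → ℚ
pairGain c z = 1ℚ + (1ℚ - fromBool (mismatch c z 2))

tripleGain : Bool → Bool → ℚ
tripleGain c z = 1ℚ + (1ℚ + (1ℚ - fromBool (mismatch (not c) z 2)))

expᵢ-pairs : ∀ p k s h c → Fresh h s c → expᵢ p h (pairs s k) ≡ chain p pairGain c k
expᵢ-pairs p zero    s h c _                   = refl
expᵢ-pairs p (suc k) s h c fresh@(stˢ , unr) = begin
  expᵢ p h (e ∷ suc s ∷ pairs e k)
    ≡⟨ expᵢ-isolated p h e (suc s ∷ pairs e k) (isolatedᵢ-true h (suc s) (unr (suc s) (ℕP.n<1+n s)) (unr e (n<2+n s)) (unr (suc e) (n<3+n s))) ⟩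
  𝔼 p (λ z → 1ℚ + expᵢ p (h⁺ z) (suc s ∷ pairs e k))
    ≡⟨ 𝔼-cong p (λ z → trans (cong (λ x → 1ℚ + x) (block z))
         (sym (+-assoc 1ℚ (1ℚ - fromBool (mismatch c z 2)) (chain p pairGain z k)))) ⟩
  chain p pairGain c (suc k) ∎
  where
  open ≡-Reasoning
  e = suc (suc s)
  h⁺ : Bool → Historyᵢ
  h⁺ z = (e , just (colour z)) ∷ h
  block : ∀ z → expᵢ p (h⁺ z) (suc s ∷ pairs e k) ≡ (1ℚ - fromBool (mismatch c z 2)) + chain p pairGain z k
  block z = trans
    (expᵢ-bridge p (h⁺ z) s c z (pairs e k) (EndState-∷ coloured h (just (colour z)) (ℕP.<⇒≢ (n<2+n s)) stˢ)
      (EndState-new h e z (unr e (n<2+n s))) (revealedᵢ-∷ h (just (colour z)) (ℕP.<⇒≢ (ℕP.n<1+n (suc s))) (unr (suc s) (ℕP.n<1+n s))))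
    (cong (λ x → (1ℚ - fromBool (mismatch c z 2)) + x)
      (expᵢ-pairs p k e ((suc s , greedyᵢ (h⁺ z) (suc s)) ∷ h⁺ z) z
        (Fresh-∷ (h⁺ z) (greedyᵢ (h⁺ z) (suc s)) (ℕP.n<1+n (suc s)) (Fresh-seed h z fresh (n<2+n s)))))

expᵢ-triples : ∀ p k s h c → Fresh h s c → expᵢ p h (triples s k) ≡ chain p tripleGain c k
expᵢ-triples p zero    s h c _                   = refl
expᵢ-triples p (suc k) s h c fresh@(stˢ , unr) = begin
  expᵢ p h (e ∷ suc s ∷ suc (suc s) ∷ triples e k)
    ≡⟨ expᵢ-isolated p h e (suc s ∷ suc (suc s) ∷ triples e k) (isolatedᵢ-true h (suc (suc s)) (unr (suc (suc s)) (n<2+n s)) (unr e (n<3+n s)) (unr (suc e) (ℕP.<-trans (n<3+n s) (ℕP.n<1+n e)))) ⟩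
  𝔼 p (λ z → 1ℚ + expᵢ p (h⁺ z) (suc s ∷ suc (suc s) ∷ triples e k))
    ≡⟨ 𝔼-cong p (λ z → trans (cong (λ x → 1ℚ + x) (block z))
         (sym (+-assoc 1ℚ (1ℚ + (1ℚ - fromBool (mismatch (not c) z 2))) (chain p tripleGain z k)))) ⟩
  chain p tripleGain c (suc k) ∎
  where
  open ≡-Reasoning
  e = suc (suc (suc s))
  h⁺ : Bool → Historyᵢ
  h⁺ z = (e , just (colour z)) ∷ h
  block : ∀ z → expᵢ p (h⁺ z) (suc s ∷ suc (suc s) ∷ triples e k)
              ≡ (1ℚ + (1ℚ - fromBool (mismatch (not c) z 2))) + chain p tripleGain z k
  block z = begin
    expᵢ p (h⁺ z) (suc s ∷ suc (suc s) ∷ triples e k)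
      ≡⟨ expᵢ-extend p (h⁺ z) (suc s) (suc (suc s) ∷ triples e k) (isolatedᵢ-falseˡ (h⁺ z) s (EndState⇒revealed (h⁺ z) s c stˢ⁺))
           (greedyᵢ-extendˡ (h⁺ z) s c stˢ⁺ u₁ u₂) ⟩
    1ℚ + expᵢ p h⁺⁺ (suc (suc s) ∷ triples e k)
      ≡⟨ cong (λ x → 1ℚ + x) (expᵢ-bridge p h⁺⁺ (suc s) (not c) z (triples e k)
           (EndState-new (h⁺ z) (suc s) (not c) u₁)
           (EndState-∷ coloured (h⁺ z) (just (colour (not c))) (ℕP.>⇒≢ (n<2+n (suc s))) (EndState-new h e z (unr e (n<3+n s))))
           (revealedᵢ-∷ (h⁺ z) (just (colour (not c))) (ℕP.>⇒≢ (ℕP.n<1+n (suc s))) u₂)) ⟩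
    1ℚ + ((1ℚ - fromBool (mismatch (not c) z 2)) + expᵢ p h⁺⁺⁺ (triples e k))
      ≡⟨ sym (+-assoc 1ℚ (1ℚ - fromBool (mismatch (not c) z 2)) (expᵢ p h⁺⁺⁺ (triples e k))) ⟩
    (1ℚ + (1ℚ - fromBool (mismatch (not c) z 2))) + expᵢ p h⁺⁺⁺ (triples e k)
      ≡⟨ cong (λ x → (1ℚ + (1ℚ - fromBool (mismatch (not c) z 2))) + x)
           (expᵢ-triples p k e h⁺⁺⁺ z (Fresh-∷ h⁺⁺ (greedyᵢ h⁺⁺ (suc (suc s))) (ℕP.n<1+n (suc (suc s)))
             (Fresh-∷ (h⁺ z) (just (colour (not c))) (n<2+n (suc s)) (Fresh-seed h z fresh (n<3+n s))))) ⟩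
    (1ℚ + (1ℚ - fromBool (mismatch (not c) z 2))) + chain p tripleGain z k ∎
    where
    stˢ⁺ = EndState-∷ coloured h (just (colour z)) (ℕP.<⇒≢ (n<3+n s)) stˢ
    u₁ = revealedᵢ-∷ h (just (colour z)) (ℕP.<⇒≢ (n<2+n (suc s))) (unr (suc s) (ℕP.n<1+n s))
    u₂ = revealedᵢ-∷ h (just (colour z)) (ℕP.<⇒≢ (ℕP.n<1+n (suc (suc s)))) (unr (suc (suc s)) (n<2+n s))
    h⁺⁺ = (suc s , just (colour (not c))) ∷ h⁺ z
    h⁺⁺⁺ = (suc (suc s) , greedyᵢ h⁺⁺ (suc (suc s))) ∷ h⁺⁺

expᵢ-chain : ∀ p g m σ → (∀ c → expᵢ p ((1 , just (colour c)) ∷ []) σ ≡ chain p g c m) →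
  expᵢ p [] (1 ∷ σ) ≡ 1ℚ + fromℕ m * 𝔼 p (λ c → 𝔼 p (g c))
expᵢ-chain p g m σ σ-chain = begin
  𝔼 p (λ c → 1ℚ + expᵢ p ((1 , just (colour c)) ∷ []) σ)  ≡⟨ 𝔼-cong p (λ c → cong (λ x → 1ℚ + x) (σ-chain c)) ⟩
  𝔼 p (λ c → 1ℚ + chain p g c m)                           ≡⟨ 𝔼-shift p 1ℚ (λ c → chain p g c m) ⟩
  1ℚ + 𝔼 p (λ c → chain p g c m)                           ≡⟨ cong (λ x → 1ℚ + x) (𝔼-chain p g m) ⟩
  1ℚ + fromℕ m * 𝔼 p (λ c → 𝔼 p (g c))                     ∎
  where open ≡-Reasoning

Fresh-start : ∀ c → Fresh ((1 , just (colour c)) ∷ []) 1 c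
Fresh-start c = EndState-new [] 1 c refl , λ j 1<j → revealedᵢ-∷ [] (just (colour c)) (ℕP.>⇒≢ 1<j) refl

expᵢ-pairFamily : ∀ p m → expᵢ p [] (1 ∷ pairs 1 m) ≡ 1ℚ + fromℕ m * 𝔼 p (λ c → 𝔼 p (pairGain c))
expᵢ-pairFamily p m = expᵢ-chain p pairGain m (pairs 1 m) (λ c → expᵢ-pairs p m 1 _ c (Fresh-start c))

expᵢ-tripleFamily : ∀ p m → expᵢ p [] (1 ∷ triples 1 m) ≡ 1ℚ + fromℕ m * 𝔼 p (λ c → 𝔼 p (tripleGain c))
expᵢ-tripleFamily p m = expᵢ-chain p tripleGain m (triples 1 m) (λ c → expᵢ-triples p m 1 _ c (Fresh-start c))

-- Optimum and competitive ratio

countColored≤length : ∀ cs → countColored cs ℕ.≤ length cs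
countColored≤length []             = z≤n
countColored≤length (just _ ∷ cs)  = s≤s (countColored≤length cs)
countColored≤length (nothing ∷ cs) = ℕP.m≤n⇒m≤1+n (countColored≤length cs)

IsOPT⇒≤length : ∀ {σ n} → IsOPT 2 σ n → n ℕ.≤ length σ
IsOPT⇒≤length ((cs , (cs-length , _) , count) , _) =
  subst₂ ℕ._≤_ count cs-length (countColored≤length cs)

edgeAt : ℕ → Edge
edgeAt i = (ℕ.pred i , i)

odd : ℕ → Bool
odd zero    = false
odd (suc n) = not (odd n)

colour-not : ∀ b → colour (not b) ≢ colour b
colour-not true  ()
colour-not false ()

edgeAt-adjacent : ∀ {i j} → i ≢ j → Adjacent (edgeAt i) (edgeAt j) → i ≡ suc j ⊎ j ≡ suc i
edgeAt-adjacent {i}     {j}     i≢j (inj₂ (inj₂ (inj₂ i≡j)))    = ⊥-elim (i≢j i≡j)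
edgeAt-adjacent {zero}  {zero}  i≢j _                           = ⊥-elim (i≢j refl)
edgeAt-adjacent {zero}  {suc _} _   (inj₁ refl)                 = inj₂ refl
edgeAt-adjacent {suc _} {zero}  _   (inj₁ refl)                 = inj₁ refl
edgeAt-adjacent {suc i} {suc j} i≢j (inj₁ i≡j)                  = ⊥-elim (i≢j (cong suc i≡j))
edgeAt-adjacent {suc i} {j}     _   (inj₂ (inj₁ refl))          = inj₁ refl
edgeAt-adjacent {zero}  {suc j} _   (inj₂ (inj₁ ()))
edgeAt-adjacent {i}     {suc j} _   (inj₂ (inj₂ (inj₁ refl)))   = inj₂ refl
edgeAt-adjacent {suc i} {zero}  _   (inj₂ (inj₂ (inj₁ ())))

alternating : List ℕ → List (Maybe ℕ)
alternating = map (λ i → just (colour (odd i)))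

alternating-Proper : ∀ σᵢ → Unique σᵢ → Proper (map edgeAt σᵢ) (alternating σᵢ)
alternating-Proper σᵢ uσᵢ = subst (AllPairs.AllPairs _) (sym (zip σᵢ))
  (AllPairs.map⁺ (AllPairs.map noClash uσᵢ))
  where
  zip : ∀ σ → zipE (map edgeAt σ) (alternating σ) ≡ map (λ i → edgeAt i , just (colour (odd i))) σ
  zip []      = refl
  zip (i ∷ σ) = cong (_ ∷_) (zip σ)
  noClash : ∀ {i j} → i ≢ j → Adjacent (edgeAt i) (edgeAt j) → ¬ Clash (just (colour (odd i))) (just (colour (odd j)))
  noClash {i} {j} i≢j adj (c , refl , eq) with edgeAt-adjacent i≢j adj
  ... | inj₁ refl = colour-not (odd j) (sym (just-injective eq))
  ... | inj₂ refl = colour-not (odd i) (just-injective eq)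

alternating-Valid : ∀ σᵢ → ValidColors 2 (alternating σᵢ)
alternating-Valid []      = []
alternating-Valid (i ∷ σ) = valid (odd i) ∷ alternating-Valid σ
  where
  valid : ∀ b c → just (colour b) ≡ just c → 1 ℕ.≤ c × c ℕ.≤ 2
  valid true  .1 refl = s≤s z≤n , s≤s z≤n
  valid false .2 refl = s≤s z≤n , s≤s (s≤s z≤n)

alternating-count : ∀ σᵢ → countColored (alternating σᵢ) ≡ length σᵢ
alternating-count []      = refl
alternating-count (i ∷ σ) = cong suc (alternating-count σ)

edgeAt-OPT : ∀ σᵢ → Unique σᵢ → IsOPT 2 (map edgeAt σᵢ) (length σᵢ)
edgeAt-OPT σᵢ uσᵢ =
    (alternating σᵢ , (trans (length-map _ σᵢ) (sym (length-map edgeAt σᵢ)) , alternating-Valid σᵢ , alternating-Proper σᵢ uσᵢ)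
    , alternating-count σᵢ)
  , λ cs (cs-length , _) → subst (countColored cs ℕ.≤_) (trans cs-length (length-map edgeAt σᵢ)) (countColored≤length cs)

nth-range : ∀ s n k → k ℕ.< n → nth (range s n) k ≡ s ℕ.+ k
nth-range s (suc n) zero    _         = sym (ℕP.+-identityʳ s)
nth-range s (suc n) (suc k) (s≤s k<n) = trans (nth-range (suc s) n k k<n) (sym (ℕP.+-suc s k))

range-bounds : ∀ s n → All (λ i → s ℕ.≤ i × i ℕ.< s ℕ.+ n) (range s n)
range-bounds s zero    = []
range-bounds s (suc n) = (ℕP.≤-refl , ℕP.m<m+n s (s≤s z≤n))
  ∷ All.map (λ {i} (s<i , i<) → ℕP.<⇒≤ s<i , subst (i ℕ.<_) (sym (ℕP.+-suc s n)) i<) (range-bounds (suc s) n)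

pathEdges-range : ∀ s n → pathEdges (range s (suc n)) ≡ map edgeAt (range (suc s) n)
pathEdges-range s zero    = refl
pathEdges-range s (suc n) = cong ((s , suc s) ∷_) (pathEdges-range (suc s) n)

module _ {σᵢ N} (σᵢ↭ : σᵢ ↭ range 1 N) where

  edgeAt-IsPathInput : IsPathInput (map edgeAt σᵢ)
  edgeAt-IsPathInput = range 0 (suc N) , pathEdges (range 0 (suc N)) , range-Unique 0 (suc N)
    , subst (map edgeAt σᵢ ↭_) (sym (pathEdges-range 0 N)) (Perm.map⁺ edgeAt σᵢ↭)
    , Pointwise.refl (inj₁ (refl , refl))

  edgeAt-Unique : Unique σᵢ
  edgeAt-Unique = Unique-resp-↭ (↭-sym σᵢ↭) (range-Unique 1 N)

  edgeAt-length : length σᵢ ≡ N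
  edgeAt-length = trans (Perm.↭-length σᵢ↭) (range-length 1 N)

  edgeAt-expRP : ∀ p → expRP p (map edgeAt σᵢ) ≡ expᵢ p [] σᵢ
  edgeAt-expRP p = expRPFrom-OnPath p (range-Unique 0 (suc N)) [] (onPath σᵢ (Perm.All-resp-↭ (↭-sym σᵢ↭) (range-bounds 1 N)))
    where
    onPath : ∀ σ → All (λ i → 1 ℕ.≤ i × i ℕ.< suc N) σ → Pointwise (OnPath (range 0 (suc N))) (map edgeAt σ) σ
    onPath []          []                  = []
    onPath (suc k ∷ σ) ((_ , k+1<) ∷ bounds) =
      (k , refl , inj₁ (sym (nth-range 0 (suc N) k (ℕP.<-trans (ℕP.n<1+n k) k+1<)) , sym (nth-range 0 (suc N) (suc k) k+1<))
         , subst (suc k ℕ.<_) (sym (range-length 0 (suc N))) k+1<)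
      ∷ onPath σ bounds

pairs↭range : ∀ s k → pairs s k ↭ range (suc s) (k ℕ.* 2)
pairs↭range s zero    = ↭-refl
pairs↭range s (suc k) = ↭-swap _ _ (pairs↭range (suc (suc s)) k)

triples↭range : ∀ s k → triples s k ↭ range (suc s) (k ℕ.* 3)
triples↭range s zero    = ↭-refl
triples↭range s (suc k) = ↭-trans (↭-swap _ _ ↭-refl) (↭-prep _ (↭-swap _ _ (triples↭range (suc (suc (suc s))) k)))

competitive-below : ∀ p r b → 0ℚ ≤ r → (∀ σ → IsPathInput σ → r * fromℕ (length σ) - b ≤ expRP p σ) →
  ∀ C → C ≤ r → CCompetitive p C
competitive-below p r b 0≤r bound C C≤r = b , λ σ path n opt → begin
  C * fromℕ n - b                ≤⟨ +-monoˡ-≤ (- b) (C*n≤r*length (IsOPT⇒≤length opt)) ⟩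
  r * fromℕ (length σ) - b       ≤⟨ bound σ path ⟩
  expRP p σ                      ∎
  where
  open ≤-Reasoning
  C*n≤r*length : ∀ {n m} → n ℕ.≤ m → C * fromℕ n ≤ r * fromℕ m
  C*n≤r*length {n} {m} n≤m with ≤-total C 0ℚ
  ... | inj₁ C≤0 = begin
    C * fromℕ n   ≤⟨ *-monoʳ-≤-nonNeg (fromℕ n) {{nonNegative (fromℕ-nonNeg n)}} C≤0 ⟩
    0ℚ * fromℕ n  ≡⟨ *-zeroˡ (fromℕ n) ⟩
    0ℚ            ≤⟨ *-nonNeg 0≤r (fromℕ-nonNeg m) ⟩
    r * fromℕ m   ∎
  ... | inj₂ 0≤C = begin
    C * fromℕ n   ≤⟨ *-monoˡ-≤-nonNeg C {{nonNegative 0≤C}} (fromℕ-mono-≤ n≤m) ⟩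
    C * fromℕ m   ≤⟨ *-monoʳ-≤-nonNeg (fromℕ m) {{nonNegative (fromℕ-nonNeg m)}} C≤r ⟩
    r * fromℕ m   ∎

not-competitive-above : ∀ p R K (σ : ℕ → Input) (N : ℕ → ℕ) → (∀ m → m ℕ.≤ N m) →
  (∀ m → IsPathInput (σ m)) → (∀ m → IsOPT 2 (σ m) (N m)) → (∀ m → expRP p (σ m) ≤ R * fromℕ (N m) + K) →
  ∀ C → R < C → ¬ CCompetitive p C
not-competitive-above p R K σ N m≤N path opt value C R<C (b , competitive) =
  <-irrefl refl (<-≤-trans b+K<δN (deficit (N m) (competitive (σ m) (path m) (N m) (opt m)) (value m)))
  where
  open ≤-Reasoning
  δ = C - R
  0<δ : 0ℚ < δ
  0<δ = subst (_< δ) (+-inverseʳ R) (+-monoˡ-< (- R) R<C)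
  m = proj₁ (archimedean δ 0<δ (b + K))
  b+K<δN : b + K < δ * fromℕ (N m)
  b+K<δN = <-≤-trans (proj₂ (archimedean δ 0<δ (b + K)))
    (*-monoˡ-≤-nonNeg δ {{nonNegative (<⇒≤ 0<δ)}} (fromℕ-mono-≤ (m≤N m)))
  deficit : ∀ n {E} → C * fromℕ n - b ≤ E → E ≤ R * fromℕ n + K → δ * fromℕ n ≤ b + K
  deficit n {E} lower upper = begin
    δ * fromℕ n                           ≡⟨ lemma C R (fromℕ n) b ⟩
    (C * fromℕ n - b) + (b - R * fromℕ n) ≤⟨ +-monoˡ-≤ (b - R * fromℕ n) (≤-trans lower upper) ⟩
    (R * fromℕ n + K) + (b - R * fromℕ n) ≡⟨ lemma′ R (fromℕ n) K b ⟩
    b + K                                 ∎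
    where
    lemma : ∀ C R n b → (C - R) * n ≡ (C * n - b) + (b - R * n)
    lemma = solve-∀ ℚ-ring
    lemma′ : ∀ R n K b → (R * n + K) + (b - R * n) ≡ b + K
    lemma′ = solve-∀ ℚ-ring

edgeAt-family-not-competitive : ∀ p R K (σᵢ : ℕ → List ℕ) (N : ℕ → ℕ) → (∀ m → m ℕ.≤ N m) →
  (∀ m → σᵢ m ↭ range 1 (N m)) → (∀ m → expᵢ p [] (σᵢ m) ≡ R * fromℕ (N m) + K) →
  ∀ C → R < C → ¬ CCompetitive p C
edgeAt-family-not-competitive p R K σᵢ N m≤N σᵢ↭ value =
  not-competitive-above p R K (map edgeAt ∘ σᵢ) N m≤N (λ m → edgeAt-IsPathInput (σᵢ↭ m))
    (λ m → subst (IsOPT 2 (map edgeAt (σᵢ m))) (edgeAt-length (σᵢ↭ m)) (edgeAt-OPT (σᵢ m) (edgeAt-Unique (σᵢ↭ m))))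
    (λ m → ≤-reflexive (trans (edgeAt-expRP (σᵢ↭ m) p) (value m)))

1-mono : ∀ {a b} → a ≤ b → 1ℚ - b ≤ 1ℚ - a
1-mono a≤b = +-monoʳ-≤ 1ℚ (neg-antimono-≤ a≤b)

module RP (p : ℚ) (0≤p : 0ℚ ≤ p) (p≤1 : p ≤ 1ℚ) where

  A B r ρ : ℚ
  A = p * p - p + 1ℚ
  B = (+ 2 / 3) * ((1ℚ - p * p) + p)
  r = A ⊓ B
  ρ = 1ℚ - r

  open ≤-Reasoning

  0≤1-p : 0ℚ ≤ 1ℚ - p
  0≤1-p = p≤q⇒0≤q-p p≤1

  pq≤ρ : p * (1ℚ - p) ≤ ρ
  pq≤ρ = begin
    p * (1ℚ - p)  ≡⟨ lemma p ⟩
    1ℚ - A        ≤⟨ 1-mono (p⊓q≤p A B) ⟩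
    ρ             ∎
    where
    lemma : ∀ p → p * (1ℚ - p) ≡ 1ℚ - (p * p - p + 1ℚ)
    lemma = solve-∀ ℚ-ring

  p²+q²≤3ρ : p * p + (1ℚ - p) * (1ℚ - p) ≤ ρ * fromℕ 3
  p²+q²≤3ρ = begin
    p * p + (1ℚ - p) * (1ℚ - p)                        ≡⟨ lemma p ⟩
    (1ℚ + 1ℚ + 1ℚ) - (1ℚ + 1ℚ) * ((1ℚ - p * p) + p)   ≡⟨ lemma′ (+ 2 / 3) ((1ℚ - p * p) + p) ⟩
    (1ℚ - B) * fromℕ 3                                 ≤⟨ *-monoʳ-≤-nonNeg (fromℕ 3) {{nonNegative (fromℕ-nonNeg 3)}} (1-mono (p⊓q≤q A B)) ⟩
    ρ * fromℕ 3                                        ∎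
    where
    lemma : ∀ p → p * p + (1ℚ - p) * (1ℚ - p) ≡ (1ℚ + 1ℚ + 1ℚ) - (1ℚ + 1ℚ) * ((1ℚ - p * p) + p)
    lemma = solve-∀ ℚ-ring
    -- applied with t = + 2 / 3, where t * (1ℚ + 1ℚ + 1ℚ) computes to 1ℚ + 1ℚ
    lemma′ : ∀ t X → (1ℚ + 1ℚ + 1ℚ) - (t * (1ℚ + 1ℚ + 1ℚ)) * X ≡ (1ℚ - t * X) * (1ℚ + 1ℚ + 1ℚ)
    lemma′ = solve-∀ ℚ-ring

  0≤ρ : 0ℚ ≤ ρ
  0≤ρ = ≤-trans (*-nonNeg 0≤p 0≤1-p) pq≤ρ

  0≤r : 0ℚ ≤ r
  0≤r = ⊓-glb
    (subst (0ℚ ≤_) (sym (lemma p)) (+-mono-≤ (*-nonNeg 0≤p 0≤p) 0≤1-p))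
    (*-nonNeg (nonNegative⁻¹ (+ 2 / 3)) (subst (0ℚ ≤_) (sym (lemma′ p)) (+-mono-≤ (nonNegative⁻¹ 1ℚ) (*-nonNeg 0≤p 0≤1-p))))
    where
    lemma : ∀ p → p * p - p + 1ℚ ≡ p * p + (1ℚ - p)
    lemma = solve-∀ ℚ-ring
    lemma′ : ∀ p → (1ℚ - p * p) + p ≡ 1ℚ + p * (1ℚ - p)
    lemma′ = solve-∀ ℚ-ring

  seed-gap : ∀ d → 2 ℕ.≤ d → 𝔼 p (λ c → mismatchRate p c d) ≤ ρ * fromℕ d
  seed-gap 1 (s≤s ())
  seed-gap 2 _ = begin
    p * (p * 0ℚ + (1ℚ - p) * 1ℚ) + (1ℚ - p) * (p * 1ℚ + (1ℚ - p) * 0ℚ)  ≡⟨ lemma p ⟩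
    p * (1ℚ - p) + p * (1ℚ - p)                                          ≤⟨ +-mono-≤ pq≤ρ pq≤ρ ⟩
    ρ + ρ                                                                ≡⟨ lemma′ ρ ⟩
    ρ * fromℕ 2                                                          ∎
    where
    lemma : ∀ p → p * (p * 0ℚ + (1ℚ - p) * 1ℚ) + (1ℚ - p) * (p * 1ℚ + (1ℚ - p) * 0ℚ) ≡ p * (1ℚ - p) + p * (1ℚ - p)
    lemma = solve-∀ ℚ-ring
    lemma′ : ∀ ρ → ρ + ρ ≡ ρ * (1ℚ + 1ℚ)
    lemma′ = solve-∀ ℚ-ring
  seed-gap 3 _ = begin
    p * (p * 1ℚ + (1ℚ - p) * 0ℚ) + (1ℚ - p) * (p * 0ℚ + (1ℚ - p) * 1ℚ)  ≡⟨ lemma p ⟩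
    p * p + (1ℚ - p) * (1ℚ - p)                                          ≤⟨ p²+q²≤3ρ ⟩
    ρ * fromℕ 3                                                          ∎
    where
    lemma : ∀ p → p * (p * 1ℚ + (1ℚ - p) * 0ℚ) + (1ℚ - p) * (p * 0ℚ + (1ℚ - p) * 1ℚ) ≡ p * p + (1ℚ - p) * (1ℚ - p)
    lemma = solve-∀ ℚ-ring
  seed-gap (suc (suc d@(suc (suc _)))) _ = begin
    𝔼 p (λ c → mismatchRate p c (suc (suc d)))
      ≡⟨ 𝔼-cong p (λ c → 𝔼-cong p (λ z → cong fromBool (mismatch-+2 c z d))) ⟩
    𝔼 p (λ c → mismatchRate p c d)
      ≤⟨ seed-gap d (s≤s (s≤s z≤n)) ⟩
    ρ * fromℕ d
      ≤⟨ *-monoˡ-≤-nonNeg ρ {{nonNegative 0≤ρ}} (fromℕ-mono-≤ (ℕP.m≤n⇒m≤1+n (ℕP.n≤1+n d))) ⟩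
    ρ * fromℕ (suc (suc d)) ∎

  open LossBound p ρ 0≤p p≤1 0≤ρ seed-gap using (bound; loss; loss-free)

  expᵢ-lower : ∀ σᵢ → Unique σᵢ → Inside 0 (suc (length σᵢ)) σᵢ → r * fromℕ (length σᵢ) - ρ ≤ expᵢ p [] σᵢ
  expᵢ-lower σᵢ uσᵢ inside = begin
    r * fromℕ n - ρ                    ≡⟨ lemma r (fromℕ n) ⟩
    fromℕ n - ρ * (1ℚ + fromℕ n)       ≡⟨ cong (λ L → fromℕ n - ρ * L) (sym (fromℕ-suc n)) ⟩
    fromℕ n - ρ * fromℕ (suc n)        ≤⟨ +-monoʳ-≤ (fromℕ n) (neg-antimono-≤ (loss-free w false false (suc n))) ⟩
    fromℕ n - loss w false false (suc n) ≤⟨ w-bound [] false false (refl , refl , λ _ _ _ → refl) ⟩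
    expᵢ p [] σᵢ                       ∎
    where
    n = length σᵢ
    w = proj₁ (bound n free 0 free (suc n) σᵢ ℕP.≤-refl uσᵢ inside)
    w-bound = proj₂ (bound n free 0 free (suc n) σᵢ ℕP.≤-refl uσᵢ inside)
    lemma : ∀ r L → r * L - (1ℚ - r) ≡ L - (1ℚ - r) * (1ℚ + L)
    lemma = solve-∀ ℚ-ring

  expRP-lower : ∀ σ → IsPathInput σ → r * fromℕ (length σ) - ρ ≤ expRP p σ
  expRP-lower σ path =
    let σᵢ , uσᵢ , inside , |σ|≡|σᵢ| , expRP≡ = path-positions σ path in
    subst₂ (λ n E → r * fromℕ n - ρ ≤ E) (sym |σ|≡|σᵢ|) (sym (expRP≡ p))
      (expᵢ-lower σᵢ uσᵢ (subst (λ n → Inside 0 (suc n) σᵢ) |σ|≡|σᵢ| inside))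

  pairFamily-value : ∀ m → expᵢ p [] (1 ∷ pairs 1 m) ≡ A * fromℕ (suc (m ℕ.* 2)) + (p - p * p)
  pairFamily-value m = begin-equality
    expᵢ p [] (1 ∷ pairs 1 m)
      ≡⟨ expᵢ-pairFamily p m ⟩
    1ℚ + fromℕ m * 𝔼 p (λ c → 𝔼 p (pairGain c))
      ≡⟨ lemma p (fromℕ m) ⟩
    A * (1ℚ + fromℕ m * (1ℚ + 1ℚ)) + (p - p * p)
      ≡⟨ cong (λ N → A * N + (p - p * p)) (sym (trans (fromℕ-suc (m ℕ.* 2)) (cong (λ x → 1ℚ + x) (fromℕ-* m 2)))) ⟩
    A * fromℕ (suc (m ℕ.* 2)) + (p - p * p) ∎
    where
    lemma : ∀ p M → 1ℚ + M * (p * (p * (1ℚ + (1ℚ - 0ℚ)) + (1ℚ - p) * (1ℚ + (1ℚ - 1ℚ)))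
                              + (1ℚ - p) * (p * (1ℚ + (1ℚ - 1ℚ)) + (1ℚ - p) * (1ℚ + (1ℚ - 0ℚ))))
                  ≡ (p * p - p + 1ℚ) * (1ℚ + M * (1ℚ + 1ℚ)) + (p - p * p)
    lemma = solve-∀ ℚ-ring

  tripleFamily-value : ∀ m → expᵢ p [] (1 ∷ triples 1 m) ≡ B * fromℕ (suc (m ℕ.* 3)) + (1ℚ - B)
  tripleFamily-value m = begin-equality
    expᵢ p [] (1 ∷ triples 1 m)
      ≡⟨ expᵢ-tripleFamily p m ⟩
    1ℚ + fromℕ m * 𝔼 p (λ c → 𝔼 p (tripleGain c))
      ≡⟨ lemma p (fromℕ m) ⟩
    1ℚ + fromℕ m * ((1ℚ + 1ℚ) * X)
      ≡⟨ lemma′ (+ 2 / 3) X (fromℕ m) ⟩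
    B * (1ℚ + fromℕ m * (1ℚ + 1ℚ + 1ℚ)) + (1ℚ - B)
      ≡⟨ cong (λ N → B * N + (1ℚ - B)) (sym (trans (fromℕ-suc (m ℕ.* 3)) (cong (λ x → 1ℚ + x) (fromℕ-* m 3)))) ⟩
    B * fromℕ (suc (m ℕ.* 3)) + (1ℚ - B) ∎
    where
    X = (1ℚ - p * p) + p
    lemma : ∀ p M → 1ℚ + M * (p * (p * (1ℚ + (1ℚ + (1ℚ - 1ℚ))) + (1ℚ - p) * (1ℚ + (1ℚ + (1ℚ - 0ℚ))))
                              + (1ℚ - p) * (p * (1ℚ + (1ℚ + (1ℚ - 0ℚ))) + (1ℚ - p) * (1ℚ + (1ℚ + (1ℚ - 1ℚ)))))
                  ≡ 1ℚ + M * ((1ℚ + 1ℚ) * ((1ℚ - p * p) + p))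
    lemma = solve-∀ ℚ-ring
    lemma′ : ∀ t X M → 1ℚ + M * ((t * (1ℚ + 1ℚ + 1ℚ)) * X) ≡ (t * X) * (1ℚ + M * (1ℚ + 1ℚ + 1ℚ)) + (1ℚ - t * X)
    lemma′ = solve-∀ ℚ-ring

  competitive-below-r : ∀ C → C < r → CCompetitive p C
  competitive-below-r C C<r = competitive-below p r ρ 0≤r expRP-lower C (<⇒≤ C<r)

  not-competitive-above-r : ∀ C → r < C → ¬ CCompetitive p C
  not-competitive-above-r C r<C with A ≤? B
  ... | yes A≤B = edgeAt-family-not-competitive p A (p - p * p) (λ m → 1 ∷ pairs 1 m) (λ m → suc (m ℕ.* 2))
                    (λ m → ℕP.m≤n⇒m≤1+n (ℕP.m≤m*n m 2)) (λ m → ↭-prep 1 (pairs↭range 1 m)) pairFamily-value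
                    C (subst (_< C) (p≤q⇒p⊓q≡p A≤B) r<C)
  ... | no A≰B  = edgeAt-family-not-competitive p B (1ℚ - B) (λ m → 1 ∷ triples 1 m) (λ m → suc (m ℕ.* 3))
                    (λ m → ℕP.m≤n⇒m≤1+n (ℕP.m≤m*n m 3)) (λ m → ↭-prep 1 (triples↭range 1 m)) tripleFamily-value
                    C (subst (_< C) (p≥q⇒p⊓q≡q (<⇒≤ (≰⇒> A≰B))) r<C)

  competitiveRatio : CompetitiveRatio p r
  competitiveRatio = competitive-below-r , not-competitive-above-r

theorem1 : (p : ℚ) → ½ ≤ p → p ≤ 1ℚ →
    CompetitiveRatio p ((p * p - p + 1ℚ) ⊓ ((+ 2 / 3) * ((1ℚ - p * p) + p)))
theorem1 p ½≤p p≤1 = RP.competitiveRatio p (≤-trans (nonNegative⁻¹ ½) ½≤p) p≤1
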